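{- Let $S \in \mathbb{Z}^{m \times m}$ be a nonsingular matrix in Smith normal form and $F \in \mathbb{Z}^{n \times m}$, and assume that the inputs to the integer relations lattice $\mathcal{R}(S,F)$ are coprime. Then, up to trivial invariant factors (those equal to $1$), the Smith form of any basis for $\mathcal{R}(S,F)$ is equal to $S$.
   Context: For $M \in \mathbb{Z}^{\ell \times m}$ of full column rank and $F \in \mathbb{Z}^{n \times m}$, the integer relations lattice is $\mathcal{R}(M,F) := \{ p \in \mathbb{Z}^{1 \times n} \mid pF = QM \text{ for some integer matrix } Q\}$, i.e. $pF$ lies in the lattice $\mathcal{L}(M)$ generated by the rows of $M$. A basis of $\mathcal{R}(M,F)$ is a nonsingular $P \in \mathbb{Z}^{n \times n}$ whose rows generate this lattice. The inputs $M$ and $F$ are called coprime if the only common integer right matrix factor of $M$ and $F$ is unimodular, equivalently the Hermite basis of the lattice generated by the rows of $M$ together with the rows of $F$ is the identity matrix. -}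

module Defs where

open import Data.Nat using (ℕ; zero; suc)
open import Data.Fin using (Fin; zero; suc; toℕ; punchIn)
open import Data.Integer using (ℤ; +_; -_; _+_; _*_; _≤_)
open import Data.Integer.Divisibility using (_∣_)
import Data.Integer.Properties as ℤP
open import Data.List using (List; []; _∷_; filter)
open import Data.Product using (Σ; _×_; ∃)
open import Data.Sum using (_⊎_)
open import Relation.Binary.PropositionalEquality using (_≡_; _≢_)
open import Relation.Nullary using (¬?)
open import Function.Bundles using (_⇔_)

Mat : ℕ → ℕ → Set
Mat r c = Fin r → Fin c → ℤ

Σ[_] : (k : ℕ) → (Fin k → ℤ) → ℤ
Σ[ zero ] f = + 0
Σ[ suc k ] f = f zero + Σ[ k ] (λ i → f (suc i))

_⊗_ : ∀ {r k c} → Mat r k → Mat k c → Mat r c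
(A ⊗ B) i j = Σ[ _ ] (λ t → A i t * B t j)

_≈M_ : ∀ {r c} → Mat r c → Mat r c → Set
A ≈M B = ∀ i j → A i j ≡ B i j

alt : ℕ → ℤ
alt zero = + 1
alt (suc k) = - alt k

det : ∀ {n} → Mat n n → ℤ
det {zero} A = + 1
det {suc n} A = Σ[ suc n ] (λ j → alt (toℕ j) * (A zero j * det (λ i k → A (suc i) (punchIn j k))))

Nonsingular : ∀ {n} → Mat n n → Set
Nonsingular A = det A ≢ + 0

Unimodular : ∀ {n} → Mat n n → Set
Unimodular A = (det A ≡ + 1) ⊎ (det A ≡ - (+ 1))

-- Row vector v (a 1×c matrix) lies in the lattice L(M) generated by the rows of M.
InLattice : ∀ {r c} → Mat r c → Mat 1 c → Set
InLattice {r} M v = ∃ λ (Q : Mat 1 r) → v ≈M (Q ⊗ M)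

-- Integer relations lattice R(M,F) = { p ∈ ℤ^{1×n} | pF ∈ L(M) }.
InRelations : ∀ {ℓ m n} → Mat ℓ m → Mat n m → Mat 1 n → Set
InRelations M F p = InLattice M (p ⊗ F)

IsRelationsBasis : ∀ {ℓ m n} → Mat ℓ m → Mat n m → Mat n n → Set
IsRelationsBasis {n = n} M F P =
  Nonsingular P × (∀ (p : Mat 1 n) → InRelations M F p ⇔ InLattice P p)

Coprime : ∀ {ℓ m n} → Mat ℓ m → Mat n m → Set
Coprime {ℓ} {m} {n} M F =
  ∀ (D : Mat m m) (A : Mat ℓ m) (B : Mat n m) →
    M ≈M (A ⊗ D) → F ≈M (B ⊗ D) → Unimodular D

IsSmithForm : ∀ {n} → Mat n n → Set
IsSmithForm {n} D =
  (∀ (i j : Fin n) → i ≢ j → D i j ≡ + 0) ×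
  (∀ (i : Fin n) → + 0 ≤ D i i) ×
  (∀ (i : Fin n) (j : Fin n) → toℕ j ≡ suc (toℕ i) → D i i ∣ D j j)

diagList : ∀ {n} → Mat n n → List ℤ
diagList {zero} D = []
diagList {suc n} D = D zero zero ∷ diagList {n} (λ i j → D (suc i) (suc j))

nontrivial : ∀ {n} → Mat n n → List ℤ
nontrivial D = filter (λ x → ¬? (x ℤP.≟ + 1)) (diagList D)

{-# OPTIONS --safe #-}

-- Write P = U D V. As U and V are unimodular, y V lies in the row lattice of P exactly when
-- y lies in that of the diagonal matrix D; as P is a basis of R(S, F), this happens exactly
-- when y V F lies in the row lattice of the diagonal matrix S. Coprimality makes the rows of
-- S and F span ℤᵐ, so y ↦ y V F induces an isomorphism ⊕ ℤ/dᵢ ≅ ⊕ ℤ/sⱼ. Tensoring with ℤ/q and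
-- counting gives ∏ gcd(q, dᵢ) = ∏ gcd(q, sⱼ) for every q > 0, and along divisor chains these
-- products determine the entries different from 1.

module Submission where

open import Defs
import Data.Integer.Properties as ℤP
open import Algebra.Properties.AbelianGroup ℤP.+-0-abelianGroup using (∙-cancelʳ)
open import Algebra.Properties.Semiring.Sum ℤP.+-*-semiring
  using (sum; ∑-distrib-+; ∑-comm; sum-remove; *-distribˡ-sum; *-distribʳ-sum)
open import Data.Fin using (Fin; zero; suc; punchIn; toℕ; fromℕ<; _≟_; _↑ˡ_; _↑ʳ_)
import Data.Fin.Properties as FinP
open import Data.Fin.Permutation using (↔⇒≡)
open import Data.Integer as ℤ using (ℤ; +_; -_; _+_; _*_; _-_; _⊖_; 0ℤ; 1ℤ; -1ℤ; ∣_∣; _%ℕ_; _/ℕ_)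
open import Data.Integer.DivMod using (n%ℕd<d; a≡a%ℕn+[a/ℕn]*n)
import Data.Integer.Divisibility as ℤᵘ
open import Data.Integer.Divisibility.Signed
  using (_∣_; divides; ∣ᵤ⇒∣; ∣⇒∣ᵤ; ∣-trans; ∣m∣n⇒∣m+n; ∣m∣n⇒∣m-n; ∣n⇒∣m*n; ∣m⇒∣m*n; ∣m⇒∣-m; 0∣⇒≡0)
open import Data.Integer.Tactic.RingSolver using (solve-∀)
open import Data.List using (List; []; _∷_; _∷ʳ_; [_]; _++_; map; filter)
import Data.List.Properties as ListP
open import Data.List.Relation.Unary.All as All using (All; []; _∷_)
import Data.List.Relation.Unary.All.Properties as AllP
open import Data.List.Relation.Unary.AllPairs using (AllPairs; []; _∷_)
open import Data.List.Relation.Unary.Linked using (Linked; []; [-]; _∷_)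
open import Data.List.Relation.Unary.Linked.Properties using (Linked⇒AllPairs)
open import Data.List.Reverse using (Reverse; []; _∶_∶ʳ_; reverseView)
open import Data.Nat as ℕ using (ℕ; zero; suc; NonZero)
import Data.Nat.Divisibility as ℕD
open import Data.Nat.GCD
  using (gcd; gcd-GCD; gcd[m,n]∣m; gcd[m,n]∣n; gcd-greatest; gcd[m,n]≤n; gcd[m,n]≢0; module Bézout)
open import Data.Nat.ListAction using (product)
open import Data.Nat.ListAction.Properties using (product-++; product≢0)
import Data.Nat.Properties as ℕP
open import Data.Product using (_×_; _,_; proj₁; proj₂; ∃; ∃₂)
open import Data.Product.Function.NonDependent.Propositional using (_×-↔_)
open import Data.Sum using (_⊎_; inj₁; inj₂)
open import Data.Unit using (⊤; tt)
open import Data.Vec.Functional using (Vector; head; tail; foldr; updateAt) renaming (_∷_ to _∷ᵥ_; _++_ to _++ᵥ_)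
open import Data.Vec.Functional.Properties
  using (updateAt-updates; updateAt-minimal; updateAt-commutes; map-updateAt-local; lookup-++ˡ; lookup-++ʳ)
open import Function using (_∘_; const; flip)
open import Function.Bundles using (_↔_; mk↔ₛ′; Equivalence)
open import Function.Properties.Inverse using (↔-trans; ↔-sym; ↔-refl)
open import Relation.Binary.Bundles using (Setoid)
open import Relation.Binary.PropositionalEquality hiding ([_])
open import Relation.Nullary using (Dec; ¬?; yes; no; contradiction)

-- Finite sums

Σ≡sum : ∀ k (f : Vector ℤ k) → Σ[ k ] f ≡ sum f
Σ≡sum zero    f = refl
Σ≡sum (suc k) f = cong (_+_ (f zero)) (Σ≡sum k (f ∘ suc))

Σ-cong : ∀ k {f g : Vector ℤ k} → f ≗ g → Σ[ k ] f ≡ Σ[ k ] g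
Σ-cong zero    f≗g = refl
Σ-cong (suc k) f≗g = cong₂ _+_ (f≗g zero) (Σ-cong k (f≗g ∘ suc))

Σ-zero : ∀ k {f : Vector ℤ k} → (∀ i → f i ≡ 0ℤ) → Σ[ k ] f ≡ 0ℤ
Σ-zero zero    f≡0 = refl
Σ-zero (suc k) f≡0 = cong₂ _+_ (f≡0 zero) (Σ-zero k (f≡0 ∘ suc))

module _ (k : ℕ) where
  open ≡-Reasoning

  Σ-+ : ∀ (f g : Vector ℤ k) → Σ[ k ] (λ i → f i + g i) ≡ Σ[ k ] f + Σ[ k ] g
  Σ-+ f g = begin
    Σ[ k ] (λ i → f i + g i)  ≡⟨ Σ≡sum k _ ⟩
    sum (λ i → f i + g i)     ≡⟨ ∑-distrib-+ f g ⟩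
    sum f + sum g             ≡⟨ cong₂ _+_ (Σ≡sum k f) (Σ≡sum k g) ⟨
    Σ[ k ] f + Σ[ k ] g       ∎

  Σ-*ˡ : ∀ c (f : Vector ℤ k) → c * Σ[ k ] f ≡ Σ[ k ] (λ i → c * f i)
  Σ-*ˡ c f = begin
    c * Σ[ k ] f              ≡⟨ cong (c *_) (Σ≡sum k f) ⟩
    c * sum f                 ≡⟨ *-distribˡ-sum c f ⟩
    sum (λ i → c * f i)       ≡⟨ Σ≡sum k _ ⟨
    Σ[ k ] (λ i → c * f i)    ∎

  Σ-*ʳ : ∀ c (f : Vector ℤ k) → Σ[ k ] f * c ≡ Σ[ k ] (λ i → f i * c)
  Σ-*ʳ c f = begin
    Σ[ k ] f * c              ≡⟨ cong (_* c) (Σ≡sum k f) ⟩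
    sum f * c                 ≡⟨ *-distribʳ-sum c f ⟩
    sum (λ i → f i * c)       ≡⟨ Σ≡sum k _ ⟨
    Σ[ k ] (λ i → f i * c)    ∎

  Σ-neg : ∀ (f : Vector ℤ k) → - Σ[ k ] f ≡ Σ[ k ] (λ i → - f i)
  Σ-neg f = begin
    - Σ[ k ] f                ≡⟨ ℤP.-1*i≡-i _ ⟨
    -1ℤ * Σ[ k ] f            ≡⟨ Σ-*ˡ -1ℤ f ⟩
    Σ[ k ] (λ i → -1ℤ * f i)  ≡⟨ Σ-cong k (ℤP.-1*i≡-i ∘ f) ⟩
    Σ[ k ] (λ i → - f i)      ∎

Σ-comm : ∀ k l (f : Fin k → Fin l → ℤ) →
  Σ[ k ] (λ i → Σ[ l ] (f i)) ≡ Σ[ l ] (λ j → Σ[ k ] (λ i → f i j))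
Σ-comm k l f = begin
  Σ[ k ] (λ i → Σ[ l ] (f i))          ≡⟨ Σ-cong k (λ i → Σ≡sum l (f i)) ⟩
  Σ[ k ] (λ i → sum (f i))             ≡⟨ Σ≡sum k _ ⟩
  sum (λ i → sum (f i))                ≡⟨ ∑-comm f ⟩
  sum (λ j → sum (λ i → f i j))        ≡⟨ Σ≡sum l _ ⟨
  Σ[ l ] (λ j → sum (λ i → f i j))     ≡⟨ Σ-cong l (λ j → Σ≡sum k (λ i → f i j)) ⟨
  Σ[ l ] (λ j → Σ[ k ] (λ i → f i j))  ∎
  where open ≡-Reasoning

Σ-remove : ∀ k (f : Vector ℤ (suc k)) i → Σ[ suc k ] f ≡ f i + Σ[ k ] (f ∘ punchIn i)
Σ-remove k f i = begin
  Σ[ suc k ] f                 ≡⟨ Σ≡sum (suc k) f ⟩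
  sum f                        ≡⟨ sum-remove f ⟩
  f i + sum (f ∘ punchIn i)    ≡⟨ cong (_+_ (f i)) (Σ≡sum k _) ⟨
  f i + Σ[ k ] (f ∘ punchIn i) ∎
  where open ≡-Reasoning

Σ-select : ∀ k (f : Vector ℤ k) i → (∀ j → j ≢ i → f j ≡ 0ℤ) → Σ[ k ] f ≡ f i
Σ-select (suc k) f i f≡0 = begin
  Σ[ suc k ] f                  ≡⟨ Σ-remove k f i ⟩
  f i + Σ[ k ] (f ∘ punchIn i)  ≡⟨ cong (_+_ (f i)) (Σ-zero k (λ j → f≡0 _ (FinP.punchInᵢ≢i i j))) ⟩
  f i + 0ℤ                      ≡⟨ ℤP.+-identityʳ (f i) ⟩
  f i                           ∎
  where open ≡-Reasoning

Σ-linear : ∀ k a b (f g : Vector ℤ k) →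
  Σ[ k ] (λ i → a * f i + b * g i) ≡ a * Σ[ k ] f + b * Σ[ k ] g
Σ-linear k a b f g = begin
  Σ[ k ] (λ i → a * f i + b * g i)                  ≡⟨ Σ-+ k _ _ ⟩
  Σ[ k ] (λ i → a * f i) + Σ[ k ] (λ i → b * g i)  ≡⟨ cong₂ _+_ (Σ-*ˡ k a f) (Σ-*ˡ k b g) ⟨
  a * Σ[ k ] f + b * Σ[ k ] g                        ∎
  where open ≡-Reasoning

Σ-*ˡ² : ∀ k a b (f : Vector ℤ k) → a * (b * Σ[ k ] f) ≡ Σ[ k ] (λ i → a * (b * f i))
Σ-*ˡ² k a b f = trans (cong (a *_) (Σ-*ˡ k b f)) (Σ-*ˡ k a _)

Σ-offdiag : ∀ k (G : Fin (suc k) → Fin (suc k) → ℤ) →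
  Σ[ suc k ] (λ i → Σ[ k ] (λ j → G i (punchIn i j))) + Σ[ suc k ] (λ i → G i i)
    ≡ Σ[ suc k ] (λ i → Σ[ suc k ] (G i))
Σ-offdiag k G = begin
  Σ[ suc k ] (λ i → Σ[ k ] (λ j → G i (punchIn i j))) + Σ[ suc k ] (λ i → G i i)
    ≡⟨ Σ-+ (suc k) (λ i → Σ[ k ] (λ j → G i (punchIn i j))) (λ i → G i i) ⟨
  Σ[ suc k ] (λ i → Σ[ k ] (λ j → G i (punchIn i j)) + G i i)
    ≡⟨ Σ-cong (suc k) (λ i → trans (ℤP.+-comm _ (G i i)) (sym (Σ-remove k (G i) i))) ⟩
  Σ[ suc k ] (λ i → Σ[ suc k ] (G i))
    ∎
  where open ≡-Reasoning

Σ-offdiag-flip : ∀ k (G : Fin (suc k) → Fin (suc k) → ℤ) →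
  Σ[ suc k ] (λ i → Σ[ k ] (λ j → G i (punchIn i j))) ≡ Σ[ suc k ] (λ i → Σ[ k ] (λ j → G (punchIn i j) i))
Σ-offdiag-flip k G = ∙-cancelʳ (Σ[ suc k ] (λ i → G i i)) _ _ (begin
  Σ[ suc k ] (λ i → Σ[ k ] (λ j → G i (punchIn i j))) + Σ[ suc k ] (λ i → G i i)
    ≡⟨ Σ-offdiag k G ⟩
  Σ[ suc k ] (λ i → Σ[ suc k ] (G i))
    ≡⟨ Σ-comm (suc k) (suc k) G ⟩
  Σ[ suc k ] (λ i → Σ[ suc k ] (λ j → G j i))
    ≡⟨ Σ-offdiag k (flip G) ⟨
  Σ[ suc k ] (λ i → Σ[ k ] (λ j → G (punchIn i j) i)) + Σ[ suc k ] (λ i → G i i)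
    ∎)
  where open ≡-Reasoning

Σ-++ : ∀ m n (f : Vector ℤ (m ℕ.+ n)) → Σ[ m ℕ.+ n ] f ≡ Σ[ m ] (f ∘ (_↑ˡ n)) + Σ[ n ] (f ∘ (m ↑ʳ_))
Σ-++ zero    n f = sym (ℤP.+-identityˡ _)
Σ-++ (suc m) n f = trans (cong (_+_ (f zero)) (Σ-++ m n (f ∘ suc))) (sym (ℤP.+-assoc (f zero) _ _))

-- Matrices

≈M-setoid : ℕ → ℕ → Setoid _ _
≈M-setoid r c = record
  { Carrier       = Mat r c
  ; _≈_           = _≈M_
  ; isEquivalence = record
    { refl  = λ i j → refl
    ; sym   = λ A≈B i j → sym (A≈B i j)
    ; trans = λ A≈B B≈C i j → trans (A≈B i j) (B≈C i j)
    }
  }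

module ≈M-Reasoning {r c : ℕ} where
  open import Relation.Binary.Reasoning.Setoid (≈M-setoid r c) public
  open Setoid (≈M-setoid r c) public using () renaming (sym to ≈M-sym; trans to ≈M-trans)

open ≈M-Reasoning using (≈M-sym; ≈M-trans)

δ : ∀ {n} → Fin n → Fin n → ℤ
δ i j with i ≟ j
... | yes _ = 1ℤ
... | no  _ = 0ℤ

δ-diag : ∀ {n} (i : Fin n) → δ i i ≡ 1ℤ
δ-diag i with i ≟ i
... | yes _  = refl
... | no i≢i = contradiction refl i≢i

δ-off : ∀ {n} {i j : Fin n} → i ≢ j → δ i j ≡ 0ℤ
δ-off {i = i} {j} i≢j with i ≟ j
... | yes i≡j = contradiction i≡j i≢j
... | no  _   = refl

δ-sym : ∀ {n} (i j : Fin n) → δ i j ≡ δ j i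
δ-sym i j with i ≟ j | j ≟ i
... | yes _   | yes _   = refl
... | no  _   | no  _   = refl
... | yes i≡j | no  j≢i = contradiction (sym i≡j) j≢i
... | no  i≢j | yes j≡i = contradiction (sym j≡i) i≢j

1M : ∀ {n} → Mat n n
1M = δ

_ᵀ : ∀ {r c} → Mat r c → Mat c r
(A ᵀ) i j = A j i

_·_ : ∀ {n m} → Vector ℤ n → Mat n m → Vector ℤ m
(y · M) j = Σ[ _ ] (λ t → y t * M t j)

row : ∀ {n} → Vector ℤ n → Mat 1 n
row y _ = y

module _ {a b c : ℕ} where

  ⊗-congˡ : ∀ {A A′ : Mat a b} (B : Mat b c) → A ≈M A′ → (A ⊗ B) ≈M (A′ ⊗ B)
  ⊗-congˡ B A≈A′ i j = Σ-cong b (λ t → cong (_* B t j) (A≈A′ i t))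

  ⊗-congʳ : ∀ (A : Mat a b) {B B′ : Mat b c} → B ≈M B′ → (A ⊗ B) ≈M (A ⊗ B′)
  ⊗-congʳ A B≈B′ i j = Σ-cong b (λ t → cong (A i t *_) (B≈B′ t j))

  ⊗-ᵀ : ∀ (A : Mat a b) (B : Mat b c) → ((A ⊗ B) ᵀ) ≈M ((B ᵀ) ⊗ (A ᵀ))
  ⊗-ᵀ A B i j = Σ-cong b (λ t → ℤP.*-comm (A j t) (B t i))

⊗-assoc : ∀ {a b c d} (A : Mat a b) (B : Mat b c) (C : Mat c d) →
  ((A ⊗ B) ⊗ C) ≈M (A ⊗ (B ⊗ C))
⊗-assoc {b = b} {c} A B C i j = begin
  Σ[ c ] (λ t → Σ[ b ] (λ s → A i s * B s t) * C t j)    ≡⟨ Σ-cong c (λ t → Σ-*ʳ b (C t j) _) ⟩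
  Σ[ c ] (λ t → Σ[ b ] (λ s → A i s * B s t * C t j))    ≡⟨ Σ-comm c b _ ⟩
  Σ[ b ] (λ s → Σ[ c ] (λ t → A i s * B s t * C t j))    ≡⟨ Σ-cong b (λ s → Σ-cong c (λ t → ℤP.*-assoc (A i s) _ _)) ⟩
  Σ[ b ] (λ s → Σ[ c ] (λ t → A i s * (B s t * C t j)))  ≡⟨ Σ-cong b (λ s → Σ-*ˡ c (A i s) _) ⟨
  Σ[ b ] (λ s → A i s * Σ[ c ] (λ t → B s t * C t j))    ∎
  where open ≡-Reasoning

⊗-identityˡ : ∀ {a b} (A : Mat a b) → (1M ⊗ A) ≈M A
⊗-identityˡ {a} A i j = begin
  Σ[ a ] (λ t → δ i t * A t j)
    ≡⟨ Σ-select a _ i (λ t t≢i → trans (cong (_* A t j) (δ-off (t≢i ∘ sym))) (ℤP.*-zeroˡ (A t j))) ⟩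
  δ i i * A i j                  ≡⟨ cong (_* A i j) (δ-diag i) ⟩
  1ℤ * A i j                     ≡⟨ ℤP.*-identityˡ (A i j) ⟩
  A i j                          ∎
  where open ≡-Reasoning

⊗-identityʳ : ∀ {a b} (A : Mat a b) → (A ⊗ 1M) ≈M A
⊗-identityʳ {b = b} A i j = begin
  Σ[ b ] (λ t → A i t * δ t j)
    ≡⟨ Σ-select b _ j (λ t t≢j → trans (cong (A i t *_) (δ-off t≢j)) (ℤP.*-zeroʳ (A i t))) ⟩
  A i j * δ j j                  ≡⟨ cong (A i j *_) (δ-diag j) ⟩
  A i j * 1ℤ                     ≡⟨ ℤP.*-identityʳ (A i j) ⟩
  A i j                          ∎
  where open ≡-Reasoning

1M-ᵀ : ∀ {n} → ((1M {n}) ᵀ) ≈M 1M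
1M-ᵀ i j = δ-sym j i

·-cong : ∀ {n m} {y z : Vector ℤ n} (M : Mat n m) → y ≗ z → ∀ j → (y · M) j ≡ (z · M) j
·-cong M y≗z j = Σ-cong _ (λ t → cong (_* M t j) (y≗z t))

·-linear : ∀ {n m} a b (y z : Vector ℤ n) (M : Mat n m) j →
  ((λ i → a * y i + b * z i) · M) j ≡ a * (y · M) j + b * (z · M) j
·-linear {n} a b y z M j = trans (Σ-cong n (λ t → distrib a b (y t) (z t) (M t j)))
                                 (Σ-linear n a b (λ t → y t * M t j) (λ t → z t * M t j))
  where
  distrib : ∀ a b y z m → (a * y + b * z) * m ≡ a * (y * m) + b * (z * m)
  distrib = solve-∀

·-⊗ : ∀ {n k m} (y : Vector ℤ n) (A : Mat n k) (B : Mat k m) j → (y · (A ⊗ B)) j ≡ ((y · A) · B) j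
·-⊗ y A B j = sym (⊗-assoc (row y) A B zero j)

Diagonal : ∀ {n} → Mat n n → Set
Diagonal D = ∀ i j → i ≢ j → D i j ≡ 0ℤ

_∣ᵛ_ : ∀ {n} → Vector ℤ n → Vector ℤ n → Set
a ∣ᵛ y = ∀ i → a i ∣ y i

diagonal : ∀ {n} → Mat n n → Vector ℤ n
diagonal D i = D i i

·-diagonal : ∀ {n} {D : Mat n n} → Diagonal D → ∀ x j → (x · D) j ≡ x j * D j j
·-diagonal {n} {D} D-diag x j =
  Σ-select n _ j (λ t t≢j → trans (cong (x t *_) (D-diag t j t≢j)) (ℤP.*-zeroʳ (x t)))

RightInverse : ∀ {n} → Mat n n → Mat n n → Set
RightInverse A B = (A ⊗ B) ≈M 1M

⊗-inverseʳ : ∀ {a n} (A : Mat a n) {B B⁻¹ : Mat n n} → RightInverse B B⁻¹ → ((A ⊗ B) ⊗ B⁻¹) ≈M A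
⊗-inverseʳ A {B} {B⁻¹} BB⁻¹≈1 = begin
  (A ⊗ B) ⊗ B⁻¹   ≈⟨ ⊗-assoc A B B⁻¹ ⟩
  A ⊗ (B ⊗ B⁻¹)   ≈⟨ ⊗-congʳ A BB⁻¹≈1 ⟩
  A ⊗ 1M          ≈⟨ ⊗-identityʳ A ⟩
  A               ∎
  where open ≈M-Reasoning

⊗-cancel : ∀ {a n c} (A : Mat a n) {B B⁻¹ : Mat n n} (C : Mat n c) → RightInverse B⁻¹ B →
  ((A ⊗ B⁻¹) ⊗ (B ⊗ C)) ≈M (A ⊗ C)
⊗-cancel A {B} {B⁻¹} C B⁻¹B≈1 = begin
  (A ⊗ B⁻¹) ⊗ (B ⊗ C)   ≈⟨ ⊗-assoc (A ⊗ B⁻¹) B C ⟨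
  ((A ⊗ B⁻¹) ⊗ B) ⊗ C   ≈⟨ ⊗-congˡ C (⊗-inverseʳ A B⁻¹B≈1) ⟩
  A ⊗ C                 ∎
  where open ≈M-Reasoning

·-difference : ∀ {n m} (y z : Vector ℤ n) (M : Mat n m) j → ((λ i → y i - z i) · M) j ≡ (y · M) j - (z · M) j
·-difference y z M j = begin
  ((λ i → y i - z i) · M) j                 ≡⟨ ·-cong M (λ i → sym (as-combination (y i) (z i))) j ⟩
  ((λ i → 1ℤ * y i + -1ℤ * z i) · M) j      ≡⟨ ·-linear 1ℤ -1ℤ y z M j ⟩
  1ℤ * (y · M) j + -1ℤ * (z · M) j          ≡⟨ as-combination ((y · M) j) ((z · M) j) ⟩
  (y · M) j - (z · M) j                     ∎
  where
  open ≡-Reasoning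
  as-combination : ∀ y z → 1ℤ * y + -1ℤ * z ≡ y - z
  as-combination = solve-∀

-- Determinants

sgn : ∀ {n} → Fin n → ℤ
sgn i = alt (toℕ i)

minor : ∀ {n} → Mat (suc n) (suc n) → Fin (suc n) → Mat n n
minor A j i k = A (suc i) (punchIn j k)

det-cong : ∀ {n} {A B : Mat n n} → A ≈M B → det A ≡ det B
det-cong {zero}  A≈B = refl
det-cong {suc n} A≈B = Σ-cong (suc n) λ j →
  cong₂ (λ a d → sgn j * (a * d)) (A≈B zero j) (det-cong (λ i k → A≈B (suc i) (punchIn j k)))

_[_]≔_ : ∀ {n m} → Mat n m → Fin n → Vector ℤ m → Mat n m
A [ k ]≔ x = updateAt A k (const x)

[]≔-at : ∀ {n m} (A : Mat n m) k x → (A [ k ]≔ x) k ≡ x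
[]≔-at A k x = updateAt-updates k A

[]≔-other : ∀ {n m} (A : Mat n m) {r k} x → r ≢ k → (A [ k ]≔ x) r ≡ A r
[]≔-other A {r} {k} x r≢k = updateAt-minimal r k A r≢k

[]≔-self : ∀ {n m} (A : Mat n m) k {x} → x ≗ A k → (A [ k ]≔ x) ≈M A
[]≔-self A k {x} x≗Ak r c with r ≟ k
... | yes refl = trans (cong-app ([]≔-at A k x) c) (x≗Ak c)
... | no  r≢k  = cong-app ([]≔-other A x r≢k) c

det-[]≔-suc : ∀ {n} (A : Mat (suc (suc n)) (suc (suc n))) k x →
  det (A [ suc k ]≔ x) ≡ Σ[ suc (suc n) ] (λ j → sgn j * (A zero j * det (minor A j [ k ]≔ (x ∘ punchIn j))))
det-[]≔-suc A k x = Σ-cong _ λ j → cong (λ d → sgn j * (A zero j * d)) (det-cong λ i c →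
  cong-app (map-updateAt-local {f = _∘ punchIn j} {const x} {const (x ∘ punchIn j)} (A ∘ suc) k refl i) c)

det-row-linear : ∀ {n} (A : Mat n n) k a b (x y : Vector ℤ n) →
  det (A [ k ]≔ (λ c → a * x c + b * y c)) ≡ a * det (A [ k ]≔ x) + b * det (A [ k ]≔ y)
det-row-linear {suc n} A zero a b x y = trans
  (Σ-cong (suc n) λ j → distrib a b (sgn j) (x j) (y j) (det (minor A j)))
  (Σ-linear (suc n) a b (λ j → sgn j * (x j * det (minor A j))) (λ j → sgn j * (y j * det (minor A j))))
  where
  distrib : ∀ a b s u v d → s * ((a * u + b * v) * d) ≡ a * (s * (u * d)) + b * (s * (v * d))
  distrib = solve-∀
det-row-linear {suc (suc n)} A (suc k) a b x y = begin
  det (A [ suc k ]≔ z)                                 ≡⟨ det-[]≔-suc A k z ⟩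
  Σ[ suc (suc n) ] (term z)                            ≡⟨ Σ-cong _ expand ⟩
  Σ[ suc (suc n) ] (λ j → a * term x j + b * term y j)  ≡⟨ Σ-linear _ a b (term x) (term y) ⟩
  a * Σ[ suc (suc n) ] (term x) + b * Σ[ suc (suc n) ] (term y)
    ≡⟨ cong₂ (λ p q → a * p + b * q) (det-[]≔-suc A k x) (det-[]≔-suc A k y) ⟨
  a * det (A [ suc k ]≔ x) + b * det (A [ suc k ]≔ y)  ∎
  where
  open ≡-Reasoning
  z : Vector ℤ (suc (suc n))
  z c = a * x c + b * y c
  term : Vector ℤ (suc (suc n)) → Fin (suc (suc n)) → ℤ
  term v j = sgn j * (A zero j * det (minor A j [ k ]≔ (v ∘ punchIn j)))
  distrib : ∀ a b s e p q → s * (e * (a * p + b * q)) ≡ a * (s * (e * p)) + b * (s * (e * q))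
  distrib = solve-∀
  expand : ∀ j → term z j ≡ a * term x j + b * term y j
  expand j = trans
    (cong (λ d → sgn j * (A zero j * d)) (det-row-linear (minor A j) k a b (x ∘ punchIn j) (y ∘ punchIn j)))
                   (distrib a b (sgn j) (A zero j) _ _)

[]≔-cong : ∀ {n m} (A : Mat n m) k {x y : Vector ℤ m} → x ≗ y → (A [ k ]≔ x) ≈M (A [ k ]≔ y)
[]≔-cong A k {x} {y} x≗y r c with r ≟ k
... | yes refl = trans (cong-app ([]≔-at A k x) c) (trans (x≗y c) (sym (cong-app ([]≔-at A k y) c)))
... | no  r≢k  = trans (cong-app ([]≔-other A x r≢k) c) (sym (cong-app ([]≔-other A y r≢k) c))

det-row-zero : ∀ {n} (A : Mat n n) k → det (A [ k ]≔ (λ _ → 0ℤ)) ≡ 0ℤ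
det-row-zero A k = begin
  det (A [ k ]≔ (λ _ → 0ℤ))                                ≡⟨ det-cong ([]≔-cong A k (λ c → sym (zeros (A k c)))) ⟩
  det (A [ k ]≔ (λ c → 0ℤ * A k c + 0ℤ * A k c))           ≡⟨ det-row-linear A k 0ℤ 0ℤ (A k) (A k) ⟩
  0ℤ * det (A [ k ]≔ A k) + 0ℤ * det (A [ k ]≔ A k)        ≡⟨ zeros (det (A [ k ]≔ A k)) ⟩
  0ℤ                                                       ∎
  where
  open ≡-Reasoning
  zeros : ∀ a → 0ℤ * a + 0ℤ * a ≡ 0ℤ
  zeros = solve-∀

det-zero-row : ∀ {n} (A : Mat n n) k → (∀ c → A k c ≡ 0ℤ) → det A ≡ 0ℤ
det-zero-row A k Ak≡0 = trans (det-cong (≈M-sym ([]≔-self A k (sym ∘ Ak≡0)))) (det-row-zero A k)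

det-row-sum : ∀ {n} (A : Mat n n) k T (w : Vector ℤ T) (X : Fin T → Vector ℤ n) →
  det (A [ k ]≔ (λ c → Σ[ T ] (λ t → w t * X t c))) ≡ Σ[ T ] (λ t → w t * det (A [ k ]≔ X t))
det-row-sum A k zero    w X = det-row-zero A k
det-row-sum A k (suc T) w X = begin
  det (A [ k ]≔ (λ c → w zero * X zero c + rest c))
    ≡⟨ det-cong ([]≔-cong A k (λ c → cong (_+_ (w zero * X zero c)) (sym (ℤP.*-identityˡ (rest c))))) ⟩
  det (A [ k ]≔ (λ c → w zero * X zero c + 1ℤ * rest c))
    ≡⟨ det-row-linear A k (w zero) 1ℤ (X zero) rest ⟩
  w zero * det (A [ k ]≔ X zero) + 1ℤ * det (A [ k ]≔ rest)
    ≡⟨ cong (_+_ (w zero * det (A [ k ]≔ X zero))) (ℤP.*-identityˡ _) ⟩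
  w zero * det (A [ k ]≔ X zero) + det (A [ k ]≔ rest)
    ≡⟨ cong (_+_ (w zero * det (A [ k ]≔ X zero))) (det-row-sum A k T (w ∘ suc) (X ∘ suc)) ⟩
  Σ[ suc T ] (λ t → w t * det (A [ k ]≔ X t))
    ∎
  where
  open ≡-Reasoning
  rest : Vector ℤ _
  rest c = Σ[ T ] (λ t → w (suc t) * X (suc t) c)

-- A total punchOut: the position of j once i is removed, junk when i = j.
punchOut′ : ∀ {n} → Fin (suc (suc n)) → Fin (suc (suc n)) → Fin (suc n)
punchOut′         zero    zero    = zero
punchOut′         zero    (suc j) = j
punchOut′         (suc i) zero    = zero
punchOut′ {zero}  (suc i) (suc j) = zero
punchOut′ {suc n} (suc i) (suc j) = suc (punchOut′ i j)

punchOut′-punchIn : ∀ {n} (i : Fin (suc (suc n))) j → punchOut′ i (punchIn i j) ≡ j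
punchOut′-punchIn          zero    j       = refl
punchOut′-punchIn          (suc i) zero    = refl
punchOut′-punchIn {suc n}  (suc i) (suc j) = cong suc (punchOut′-punchIn i j)

punchIn-punchOut′ : ∀ {n} (i : Fin (suc (suc n))) j c →
  punchIn (punchIn i j) (punchIn (punchOut′ (punchIn i j) i) c) ≡ punchIn i (punchIn j c)
punchIn-punchOut′          zero    j       c       = refl
punchIn-punchOut′          (suc i) zero    c       = refl
punchIn-punchOut′ {suc n}  (suc i) (suc j) zero    = refl
punchIn-punchOut′ {suc n}  (suc i) (suc j) (suc c) = cong suc (punchIn-punchOut′ i j c)

sgn-punchOut′ : ∀ {n} (i : Fin (suc (suc n))) j →
  sgn (punchIn i j) * sgn (punchOut′ (punchIn i j) i) ≡ - (sgn i * sgn j)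
sgn-punchOut′          zero    j       = sign-identity (sgn j)
  where
  sign-identity : ∀ s → - s * 1ℤ ≡ - (1ℤ * s)
  sign-identity = solve-∀
sgn-punchOut′          (suc i) zero    = sign-identity (sgn i)
  where
  sign-identity : ∀ s → 1ℤ * s ≡ - (- s * 1ℤ)
  sign-identity = solve-∀
sgn-punchOut′ {suc n}  (suc i) (suc j) =
  trans (neg*neg (sgn (punchIn i j)) (sgn (punchOut′ (punchIn i j) i)))
        (trans (sgn-punchOut′ i j) (cong -_ (sym (neg*neg (sgn i) (sgn j)))))
  where
  neg*neg : ∀ a b → - a * - b ≡ a * b
  neg*neg = solve-∀

≡-neg⇒≡0 : ∀ {t} → t ≡ - t → t ≡ 0ℤ
≡-neg⇒≡0 {t} t≡-t = ℤP.*-cancelˡ-≡ (+ 2) t 0ℤ (begin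
  + 2 * t  ≡⟨ double t ⟩
  t + t    ≡⟨ cong (_+_ t) t≡-t ⟩
  t - t    ≡⟨ ℤP.+-inverseʳ t ⟩
  0ℤ       ∎)
  where
  open ≡-Reasoning
  double : ∀ t → + 2 * t ≡ t + t
  double = solve-∀

-- Expanding along rows 0 and 1, the terms for the column pairs (x, y) and (y, x) cancel.
det-rows01-equal : ∀ {n} (A : Mat (suc (suc n)) (suc (suc n))) → A zero ≗ A (suc zero) → det A ≡ 0ℤ
det-rows01-equal {n} A A₀≗A₁ = ≡-neg⇒≡0 (begin
  det A                                          ≡⟨ Σ-cong _ expand ⟩
  Σ[ suc (suc n) ] (λ i → Σ[ suc n ] (λ j → G i (punchIn i j)))
    ≡⟨ Σ-offdiag-flip (suc n) G ⟩
  Σ[ suc (suc n) ] (λ i → Σ[ suc n ] (λ j → G (punchIn i j) i))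
    ≡⟨ Σ-cong _ (λ i → Σ-cong _ (G-antisymmetric i)) ⟩
  Σ[ suc (suc n) ] (λ i → Σ[ suc n ] (λ j → - G i (punchIn i j)))
    ≡⟨ trans (Σ-neg _ (λ i → Σ[ suc n ] (λ j → G i (punchIn i j))))
             (Σ-cong _ (λ i → Σ-neg _ (λ j → G i (punchIn i j)))) ⟨
  - Σ[ suc (suc n) ] (λ i → Σ[ suc n ] (λ j → G i (punchIn i j)))
    ≡⟨ cong -_ (Σ-cong _ expand) ⟨
  - det A                                        ∎)
  where
  open ≡-Reasoning
  r = A zero
  G′ : Fin (suc (suc n)) → Fin (suc (suc n)) → Fin (suc n) → ℤ
  G′ x y l = sgn x * sgn l * (r x * r y * det (minor (minor A x) l))
  G : Fin (suc (suc n)) → Fin (suc (suc n)) → ℤ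
  G x y = G′ x y (punchOut′ x y)
  expand : ∀ i → sgn i * (r i * det (minor A i)) ≡ Σ[ suc n ] (λ j → G i (punchIn i j))
  expand i = trans (Σ-*ˡ² _ (sgn i) (r i) (λ j → sgn j * (A (suc zero) (punchIn i j) * det (minor (minor A i) j))))
                   (Σ-cong _ λ j → begin
    sgn i * (r i * (sgn j * (A (suc zero) (punchIn i j) * det (minor (minor A i) j))))
      ≡⟨ cong (λ a → sgn i * (r i * (sgn j * (a * det (minor (minor A i) j))))) (sym (A₀≗A₁ (punchIn i j))) ⟩
    sgn i * (r i * (sgn j * (r (punchIn i j) * det (minor (minor A i) j))))
      ≡⟨ reassoc (sgn i) (r i) (sgn j) (r (punchIn i j)) (det (minor (minor A i) j)) ⟩
    G′ i (punchIn i j) j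
      ≡⟨ cong (G′ i (punchIn i j)) (punchOut′-punchIn i j) ⟨
    G i (punchIn i j) ∎)
    where
    reassoc : ∀ s a t b d → s * (a * (t * (b * d))) ≡ s * t * (a * b * d)
    reassoc = solve-∀
  G-antisymmetric : ∀ i j → G (punchIn i j) i ≡ - G i (punchIn i j)
  G-antisymmetric i j = begin
    sgn y * sgn (punchOut′ y i) * (r y * r i * det (minor (minor A y) (punchOut′ y i)))
      ≡⟨ cong₂ (λ s d → s * (r y * r i * d)) (sgn-punchOut′ i j)
               (det-cong (λ a c → cong (A (suc (suc a))) (punchIn-punchOut′ i j c))) ⟩
    - (sgn i * sgn j) * (r y * r i * det (minor (minor A i) j))
      ≡⟨ swap (sgn i * sgn j) (r y) (r i) (det (minor (minor A i) j)) ⟩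
    - G′ i y j
      ≡⟨ cong (λ l → - G′ i y l) (punchOut′-punchIn i j) ⟨
    - G i y ∎
    where
    y = punchIn i j
    swap : ∀ s a b d → - s * (a * b * d) ≡ - (s * (b * a * d))
    swap = solve-∀

det-row-+ : ∀ {n} (A : Mat n n) k (x y : Vector ℤ n) →
  det (A [ k ]≔ (λ c → x c + y c)) ≡ det (A [ k ]≔ x) + det (A [ k ]≔ y)
det-row-+ A k x y = begin
  det (A [ k ]≔ (λ c → x c + y c))                    ≡⟨ det-cong ([]≔-cong A k (λ c → sym (ones (x c) (y c)))) ⟩
  det (A [ k ]≔ (λ c → 1ℤ * x c + 1ℤ * y c))          ≡⟨ det-row-linear A k 1ℤ 1ℤ x y ⟩
  1ℤ * det (A [ k ]≔ x) + 1ℤ * det (A [ k ]≔ y)       ≡⟨ ones (det (A [ k ]≔ x)) (det (A [ k ]≔ y)) ⟩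
  det (A [ k ]≔ x) + det (A [ k ]≔ y)                 ∎
  where
  open ≡-Reasoning
  ones : ∀ a b → 1ℤ * a + 1ℤ * b ≡ a + b
  ones = solve-∀

-- Alternating forms are antisymmetric: expand det with rows i, k both set to A i + A k.
det-swap : ∀ {n} (A : Mat n n) {i k} → i ≢ k → (∀ (B : Mat n n) → B i ≗ B k → det B ≡ 0ℤ) →
  det A + det ((A [ i ]≔ A k) [ k ]≔ A i) ≡ 0ℤ
det-swap {n} A {i} {k} i≢k alternating = begin
  det A + Z y x                      ≡⟨ cong (_+ Z y x) Zxy≡detA ⟨
  Z x y + Z y x                      ≡⟨ cong₂ _+_ (ℤP.+-identityˡ (Z x y)) (ℤP.+-identityʳ (Z y x)) ⟨
  (0ℤ + Z x y) + (Z y x + 0ℤ)        ≡⟨ cong₂ (λ p q → (p + Z x y) + (Z y x + q)) (Z-diag x) (Z-diag y) ⟨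
  (Z x x + Z x y) + (Z y x + Z y y)  ≡⟨ cong₂ _+_ (det-row-+ (A [ i ]≔ x) k x y) (det-row-+ (A [ i ]≔ y) k x y) ⟨
  Z x s + Z y s                      ≡⟨ Z-linearˡ ⟨
  Z s s                              ≡⟨ Z-diag s ⟩
  0ℤ                                 ∎
  where
  open ≡-Reasoning
  x = A i
  y = A k
  s : Vector ℤ n
  s c = x c + y c
  Z : Vector ℤ n → Vector ℤ n → ℤ
  Z u v = det ((A [ i ]≔ u) [ k ]≔ v)
  Z-diag : ∀ u → Z u u ≡ 0ℤ
  Z-diag u = alternating _ λ c → trans (cong-app ([]≔-other (A [ i ]≔ u) u i≢k) c)
    (trans (cong-app ([]≔-at A i u) c) (sym (cong-app ([]≔-at (A [ i ]≔ u) k u) c)))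
  commute : ∀ u v → ((A [ i ]≔ u) [ k ]≔ v) ≈M ((A [ k ]≔ v) [ i ]≔ u)
  commute u v r = cong-app (updateAt-commutes k i (i≢k ∘ sym) A r)
  Z-linearˡ : Z s s ≡ Z x s + Z y s
  Z-linearˡ = trans (det-cong (commute s s)) (trans (det-row-+ (A [ k ]≔ s) i x y)
    (sym (cong₂ _+_ (det-cong (commute x s)) (det-cong (commute y s)))))
  Zxy≡detA : Z x y ≡ det A
  Zxy≡detA = det-cong (≈M-trans ([]≔-self (A [ i ]≔ x) k (λ c → sym (cong-app ([]≔-other A x (i≢k ∘ sym)) c)))
                                ([]≔-self A i (λ _ → refl)))

det-equal-rows-suc : ∀ {n} → (∀ (B : Mat n n) {i k} → i ≢ k → B i ≗ B k → det B ≡ 0ℤ) →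
  ∀ (A : Mat (suc n) (suc n)) {i k} → i ≢ k → A (suc i) ≗ A (suc k) → det A ≡ 0ℤ
det-equal-rows-suc alternating A i≢k Ai≗Ak = Σ-zero _ λ j →
  trans (cong (λ d → sgn j * (A zero j * d)) (alternating (minor A j) i≢k (Ai≗Ak ∘ punchIn j)))
        (trans (cong (sgn j *_) (ℤP.*-zeroʳ (A zero j))) (ℤP.*-zeroʳ (sgn j)))

-- Swapping rows 1 and k+2 reduces to det-rows01-equal.
det-row0-equal : ∀ {n} → (∀ (B : Mat (suc n) (suc n)) {i k} → i ≢ k → B i ≗ B k → det B ≡ 0ℤ) →
  ∀ (A : Mat (suc (suc n)) (suc (suc n))) k → A zero ≗ A (suc k) → det A ≡ 0ℤ
det-row0-equal alternating A zero    A₀≗A₁ = det-rows01-equal A A₀≗A₁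
det-row0-equal alternating A (suc k) A₀≗Aₖ = begin
  det A                  ≡⟨ ℤP.+-identityʳ (det A) ⟨
  det A + 0ℤ             ≡⟨ cong (_+_ (det A)) (det-rows01-equal B A₀≗Aₖ) ⟨
  det A + det B          ≡⟨ det-swap A (λ ()) (λ B′ → det-equal-rows-suc alternating B′ {zero} {suc k} (λ ())) ⟩
  0ℤ                     ∎
  where
  open ≡-Reasoning
  B = (A [ suc zero ]≔ A (suc (suc k))) [ suc (suc k) ]≔ A (suc zero)

det-equal-rows : ∀ {n} (A : Mat n n) {i k} → i ≢ k → A i ≗ A k → det A ≡ 0ℤ
det-equal-rows {suc n}       A {zero}  {zero}  0≢0 = contradiction refl 0≢0
det-equal-rows {suc n}       A {suc i} {suc k} i≢k = det-equal-rows-suc det-equal-rows A (i≢k ∘ cong suc)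
det-equal-rows {suc (suc n)} A {zero}  {suc k} _   = det-row0-equal det-equal-rows A k
det-equal-rows {suc (suc n)} A {suc i} {zero}  _   = det-row0-equal det-equal-rows A i ∘ (sym ∘_)

adj : ∀ {n} → Mat n n → Mat n n
adj A j k = det (A [ k ]≔ δ j)

⊗-adj : ∀ {n} (A : Mat n n) i k → (A ⊗ adj A) i k ≡ det A * δ i k
⊗-adj {n} A i k = begin
  Σ[ n ] (λ j → A i j * det (A [ k ]≔ δ j))             ≡⟨ det-row-sum A k n (A i) δ ⟨
  det (A [ k ]≔ (λ c → Σ[ n ] (λ j → A i j * δ j c)))  ≡⟨ det-cong ([]≔-cong A k (⊗-identityʳ A i)) ⟩
  det (A [ k ]≔ A i)                                    ≡⟨ row-i-at-k ⟩
  det A * δ i k                                         ∎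
  where
  open ≡-Reasoning
  row-i-at-k : det (A [ k ]≔ A i) ≡ det A * δ i k
  row-i-at-k with i ≟ k
  ... | yes refl = trans (det-cong ([]≔-self A i (λ _ → refl))) (sym (ℤP.*-identityʳ (det A)))
  ... | no  i≢k  = trans (det-equal-rows (A [ k ]≔ A i) i≢k (λ c →
                           trans (cong-app ([]≔-other A (A i) i≢k) c) (sym (cong-app ([]≔-at A k (A i)) c))))
                         (sym (ℤP.*-zeroʳ (det A)))

det²≡1⇒rightInverse : ∀ {n} (A : Mat n n) → det A * det A ≡ 1ℤ → ∃ (RightInverse A)
det²≡1⇒rightInverse {n} A det²≡1 = (λ j k → det A * adj A j k) , λ i k → begin
  Σ[ n ] (λ j → A i j * (det A * adj A j k))   ≡⟨ Σ-cong n (λ j → swap (A i j) (det A) (adj A j k)) ⟩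
  Σ[ n ] (λ j → det A * (A i j * adj A j k))   ≡⟨ Σ-*ˡ n (det A) _ ⟨
  det A * (A ⊗ adj A) i k                      ≡⟨ cong (det A *_) (⊗-adj A i k) ⟩
  det A * (det A * δ i k)                      ≡⟨ ℤP.*-assoc (det A) (det A) (δ i k) ⟨
  det A * det A * δ i k                        ≡⟨ cong (_* δ i k) det²≡1 ⟩
  1ℤ * δ i k                                   ≡⟨ ℤP.*-identityˡ (δ i k) ⟩
  δ i k                                        ∎
  where
  open ≡-Reasoning
  swap : ∀ a d b → a * (d * b) ≡ d * (a * b)
  swap = solve-∀

colMinor : ∀ {n} → Mat (suc n) (suc n) → Fin (suc n) → Mat n n
colMinor A i r c = A (punchIn i r) (suc c)

det-column-expansion : ∀ {n} (A : Mat (suc n) (suc n)) →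
  det A ≡ Σ[ suc n ] (λ i → sgn i * (A i zero * det (colMinor A i)))
det-column-expansion {zero}  A = refl
det-column-expansion {suc n} A =
  cong (_+_ (sgn {suc (suc n)} zero * (A zero zero * det (minor A zero)))) (begin
    Σ[ suc n ] (λ j → - sgn j * (A zero (suc j) * det (minor A (suc j))))
      ≡⟨ Σ-cong _ (λ j → cong (λ d → - sgn j * (A zero (suc j) * d)) (det-column-expansion (minor A (suc j)))) ⟩
    Σ[ suc n ] (λ j → - sgn j * (A zero (suc j) * Σ[ suc n ] (λ i → sgn i * (A (suc i) zero * det (M i j)))))
      ≡⟨ Σ-cong _ (λ j → Σ-*ˡ² _ (- sgn j) (A zero (suc j)) (λ i → sgn i * (A (suc i) zero * det (M i j)))) ⟩
    Σ[ suc n ] (λ j → Σ[ suc n ] (λ i → - sgn j * (A zero (suc j) * (sgn i * (A (suc i) zero * det (M i j))))))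
      ≡⟨ Σ-comm _ _ (λ j i → - sgn j * (A zero (suc j) * (sgn i * (A (suc i) zero * det (M i j))))) ⟩
    Σ[ suc n ] (λ i → Σ[ suc n ] (λ j → - sgn j * (A zero (suc j) * (sgn i * (A (suc i) zero * det (M i j))))))
      ≡⟨ Σ-cong _ (λ i → Σ-cong _ (λ j → swap (sgn j) (A zero (suc j)) (sgn i) (A (suc i) zero) (det (M i j)))) ⟩
    Σ[ suc n ] (λ i → Σ[ suc n ] (λ j → - sgn i * (A (suc i) zero * (sgn j * (A zero (suc j) * det (M i j))))))
      ≡⟨ Σ-cong _ (λ i → Σ-*ˡ² _ (- sgn i) (A (suc i) zero) (λ j → sgn j * (A zero (suc j) * det (M i j)))) ⟨
    Σ[ suc n ] (λ i → - sgn i * (A (suc i) zero * Σ[ suc n ] (λ j → sgn j * (A zero (suc j) * det (M i j)))))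
      ∎)
  where
  open ≡-Reasoning
  M : Fin (suc n) → Fin (suc n) → Mat n n
  M i j r c = A (suc (punchIn i r)) (suc (punchIn j c))
  swap : ∀ s a t b d → - s * (a * (t * (b * d))) ≡ - t * (b * (s * (a * d)))
  swap = solve-∀

det-ᵀ : ∀ {n} (A : Mat n n) → det (A ᵀ) ≡ det A
det-ᵀ {zero}  A = refl
det-ᵀ {suc n} A = trans (Σ-cong _ λ j → cong (λ d → sgn j * (A j zero * d)) (det-ᵀ (colMinor A j)))
                        (sym (det-column-expansion A))

Invertible : ∀ {n} → Mat n n → Set
Invertible A = ∃ λ A⁻¹ → RightInverse A A⁻¹ × RightInverse A⁻¹ A

-- A left inverse is the transpose of a right inverse of the transpose; the two then coincide.
unimodular⇒invertible : ∀ {n} (A : Mat n n) → Unimodular A → Invertible A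
unimodular⇒invertible A unimodular = R , A⊗R≈1 , R⊗A≈1
  where
  open ≈M-Reasoning
  det²≡1 : ∀ {d} → d ≡ 1ℤ ⊎ d ≡ -1ℤ → d * d ≡ 1ℤ
  det²≡1 (inj₁ refl) = refl
  det²≡1 (inj₂ refl) = refl
  right = det²≡1⇒rightInverse A (det²≡1 unimodular)
  R = proj₁ right
  A⊗R≈1 = proj₂ right
  rightᵀ = det²≡1⇒rightInverse (A ᵀ) (subst (λ d → d * d ≡ 1ℤ) (sym (det-ᵀ A)) (det²≡1 unimodular))
  L = proj₁ rightᵀ ᵀ
  L⊗A≈1 : (L ⊗ A) ≈M 1M
  L⊗A≈1 = begin
    L ⊗ A                     ≈⟨ ⊗-ᵀ (A ᵀ) (proj₁ rightᵀ) ⟨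
    ((A ᵀ) ⊗ proj₁ rightᵀ) ᵀ  ≈⟨ (λ i j → proj₂ rightᵀ j i) ⟩
    1M ᵀ                      ≈⟨ 1M-ᵀ ⟩
    1M                        ∎
  R≈L : R ≈M L
  R≈L = begin
    R              ≈⟨ ⊗-identityˡ R ⟨
    1M ⊗ R         ≈⟨ ⊗-congˡ R L⊗A≈1 ⟨
    (L ⊗ A) ⊗ R    ≈⟨ ⊗-assoc L A R ⟩
    L ⊗ (A ⊗ R)    ≈⟨ ⊗-congʳ L A⊗R≈1 ⟩
    L ⊗ 1M         ≈⟨ ⊗-identityʳ L ⟩
    L              ∎
  R⊗A≈1 : (R ⊗ A) ≈M 1M
  R⊗A≈1 = ≈M-trans (⊗-congˡ A R≈L) L⊗A≈1

diagonal-nonsingular : ∀ {n} (S : Mat n n) → Diagonal S → Nonsingular S → ∀ i → S i i ≢ 0ℤ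
diagonal-nonsingular S offDiag nonsingular i Sᵢᵢ≡0 = nonsingular (det-zero-row S i λ c → Sᵢc≡0 c)
  where
  Sᵢc≡0 : ∀ c → S i c ≡ 0ℤ
  Sᵢc≡0 c with i ≟ c
  ... | yes refl = Sᵢᵢ≡0
  ... | no  i≢c  = offDiag i c i≢c

-- Row lattices

+∣i∣≡ε*i : ∀ i → ∃ λ ε → + ∣ i ∣ ≡ ε * i
+∣i∣≡ε*i i with ℤP.+∣i∣≡i⊎+∣i∣≡-i i
... | inj₁ eq = 1ℤ  , trans eq (sym (ℤP.*-identityˡ i))
... | inj₂ eq = -1ℤ , trans eq (sym (ℤP.-1*i≡-i i))

private
  ℕ-identity⇒ℤ : ∀ {d} x y a b εa εb → d ℕ.+ y ℕ.* ∣ b ∣ ≡ x ℕ.* ∣ a ∣ → + ∣ a ∣ ≡ εa * a → + ∣ b ∣ ≡ εb * b →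
    + d ≡ + x * εa * a + - (+ y * εb) * b
  ℕ-identity⇒ℤ {d} x y a b εa εb eq a≡ b≡ = begin
    + d                                          ≡⟨ cancel (+ d) (+ y * + ∣ b ∣) ⟨
    + d + + y * + ∣ b ∣ - + y * + ∣ b ∣          ≡⟨ cong (λ t → + d + t - + y * + ∣ b ∣) (ℤP.pos-* y ∣ b ∣) ⟨
    + d + + (y ℕ.* ∣ b ∣) - + y * + ∣ b ∣        ≡⟨ cong (_- + y * + ∣ b ∣) (ℤP.pos-+ d (y ℕ.* ∣ b ∣)) ⟨
    + (d ℕ.+ y ℕ.* ∣ b ∣) - + y * + ∣ b ∣        ≡⟨ cong (λ t → + t - + y * + ∣ b ∣) eq ⟩
    + (x ℕ.* ∣ a ∣) - + y * + ∣ b ∣              ≡⟨ cong (_- + y * + ∣ b ∣) (ℤP.pos-* x ∣ a ∣) ⟩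
    + x * + ∣ a ∣ - + y * + ∣ b ∣                ≡⟨ cong₂ (λ p q → + x * p - + y * q) a≡ b≡ ⟩
    + x * (εa * a) - + y * (εb * b)              ≡⟨ regroup (+ x) εa a (+ y) εb b ⟩
    + x * εa * a + - (+ y * εb) * b              ∎
    where
    open ≡-Reasoning
    cancel : ∀ d c → d + c - c ≡ d
    cancel = solve-∀
    regroup : ∀ x εa a y εb b → x * (εa * a) - y * (εb * b) ≡ x * εa * a + - (y * εb) * b
    regroup = solve-∀

bézout : ∀ a b → ∃₂ λ x y → + gcd ∣ a ∣ ∣ b ∣ ≡ x * a + y * b
bézout a b with +∣i∣≡ε*i a | +∣i∣≡ε*i b | Bézout.identity (gcd-GCD ∣ a ∣ ∣ b ∣)
... | εa , a≡ | εb , b≡ | Bézout.+- x y eq = + x * εa , - (+ y * εb) , ℕ-identity⇒ℤ x y a b εa εb eq a≡ b≡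
... | εa , a≡ | εb , b≡ | Bézout.-+ x y eq = - (+ x * εa) , + y * εb ,
  trans (ℕ-identity⇒ℤ y x b a εb εa eq b≡ a≡) (ℤP.+-comm (+ y * εb * b) (- (+ x * εa) * a))

gcd-combination : ∀ k (a : Vector ℤ k) → ∃ λ (u : Vector ℤ k) → ∀ t → Σ[ k ] (λ s → u s * a s) ∣ a t
gcd-combination zero    a = (λ ()) , λ ()
gcd-combination (suc k) a = u , g∣a
  where
  rest = gcd-combination k (a ∘ suc)
  u′ = proj₁ rest
  c = Σ[ k ] (λ s → u′ s * a (suc s))
  x = proj₁ (bézout (a zero) c)
  y = proj₁ (proj₂ (bézout (a zero) c))
  u : Vector ℤ (suc k)
  u = x ∷ᵥ (λ s → y * u′ s)
  g≡ : + gcd ∣ a zero ∣ ∣ c ∣ ≡ Σ[ suc k ] (λ s → u s * a s)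
  g≡ = trans (proj₂ (proj₂ (bézout (a zero) c))) (cong (_+_ (x * a zero))
         (trans (Σ-*ˡ k y (λ s → u′ s * a (suc s))) (Σ-cong k (λ s → sym (ℤP.*-assoc y (u′ s) (a (suc s)))))))
  g∣a : ∀ t → Σ[ suc k ] (λ s → u s * a s) ∣ a t
  g∣a zero    = subst (_∣ a zero) g≡ (∣ᵤ⇒∣ (gcd[m,n]∣m ∣ a zero ∣ ∣ c ∣))
  g∣a (suc t) = subst (_∣ a (suc t)) g≡ (∣-trans (∣ᵤ⇒∣ (gcd[m,n]∣n ∣ a zero ∣ ∣ c ∣)) (proj₂ rest t))

-- The rows of A lie in the row lattice of B; in particular InLattice M v is v ⊑ M.
_⊑_ : ∀ {k l m} → Mat k m → Mat l m → Set
A ⊑ B = ∃ λ C → A ≈M (C ⊗ B)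

⊑-trans : ∀ {k l p m} {A : Mat k m} {B : Mat l m} {C : Mat p m} → A ⊑ B → B ⊑ C → A ⊑ C
⊑-trans {A = A} {B} {C} (X , A≈XB) (Y , B≈YC) = X ⊗ Y , (begin
  A            ≈⟨ A≈XB ⟩
  X ⊗ B        ≈⟨ ⊗-congʳ X B≈YC ⟩
  X ⊗ (Y ⊗ C)  ≈⟨ ⊗-assoc X Y C ⟨
  (X ⊗ Y) ⊗ C  ∎)
  where open ≈M-Reasoning

⊑-respʳ : ∀ {k l m} {A : Mat k m} {B B′ : Mat l m} → B ≈M B′ → A ⊑ B → A ⊑ B′
⊑-respʳ {A = A} B≈B′ (Q , A≈QB) = Q , ≈M-trans A≈QB (⊗-congʳ Q B≈B′)

-- Column elimination: a combination h of the rows with h₀ = gcd of the first column clears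
-- that column from every other row, and recursion handles the remaining columns.
squareGenerator : ∀ m k (G : Mat k m) → ∃ λ (H : Mat m m) → G ⊑ H × H ⊑ G
squareGenerator zero    k G = (λ ()) , ((λ _ ()) , λ _ ()) , ((λ ()) , λ ())
squareGenerator (suc m) k G = H , ((λ t → α t ∷ᵥ C₁ t) , G≈) , (C , H≈)
  where
  open ≡-Reasoning
  comb = gcd-combination k (λ t → G t zero)
  u = proj₁ comb
  h : Vector ℤ (suc m)
  h = u · G
  α : Vector ℤ k
  α t = _∣_.quotient (proj₂ comb t)
  α-eq : ∀ t → G t zero ≡ α t * h zero
  α-eq t = _∣_.equality (proj₂ comb t)
  E : Mat k (suc m)
  E t j = G t j - α t * h j
  E-zero : ∀ t → E t zero ≡ 0ℤ
  E-zero t = trans (cong (_- α t * h zero) (α-eq t)) (ℤP.+-inverseʳ (α t * h zero))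
  rec = squareGenerator m k (λ t j → E t (suc j))
  H′ = proj₁ rec
  C₁ = proj₁ (proj₁ (proj₂ rec))
  G′≈ = proj₂ (proj₁ (proj₂ rec))
  C₂ = proj₁ (proj₂ (proj₂ rec))
  H′≈ = proj₂ (proj₂ (proj₂ rec))
  H : Mat (suc m) (suc m)
  H zero          = h
  H (suc r) zero    = 0ℤ
  H (suc r) (suc j) = H′ r j
  G≈ : G ≈M ((λ t → α t ∷ᵥ C₁ t) ⊗ H)
  G≈ t zero    = sym (begin
    α t * h zero + Σ[ m ] (λ r → C₁ t r * 0ℤ)  ≡⟨ cong (_+_ (α t * h zero)) (Σ-zero m (ℤP.*-zeroʳ ∘ C₁ t)) ⟩
    α t * h zero + 0ℤ                          ≡⟨ ℤP.+-identityʳ _ ⟩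
    α t * h zero                               ≡⟨ α-eq t ⟨
    G t zero                                   ∎)
  G≈ t (suc j) = sym (begin
    α t * h (suc j) + (C₁ ⊗ H′) t j  ≡⟨ cong (_+_ (α t * h (suc j))) (G′≈ t j) ⟨
    α t * h (suc j) + E t (suc j)    ≡⟨ add-back (G t (suc j)) (α t * h (suc j)) ⟩
    G t (suc j)                      ∎)
    where
    add-back : ∀ g a → a + (g - a) ≡ g
    add-back = solve-∀
  β : Vector ℤ m
  β r = Σ[ k ] (λ t → C₂ r t * α t)
  C : Mat (suc m) k
  C zero    = u
  C (suc r) t = C₂ r t - β r * u t
  combination-E : ∀ r j → (C ⊗ G) (suc r) j ≡ Σ[ k ] (λ t → C₂ r t * E t j)
  combination-E r j = begin
    Σ[ k ] (λ t → (C₂ r t - β r * u t) * G t j)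
      ≡⟨ Σ-cong k (λ t → split₁ (C₂ r t) (β r) (u t) (G t j)) ⟩
    Σ[ k ] (λ t → 1ℤ * (C₂ r t * G t j) + - β r * (u t * G t j))
      ≡⟨ Σ-linear k 1ℤ (- β r) _ _ ⟩
    1ℤ * Σ[ k ] (λ t → C₂ r t * G t j) + - β r * h j
      ≡⟨ cong (_+_ (1ℤ * Σ[ k ] (λ t → C₂ r t * G t j))) (swap (β r) (h j)) ⟩
    1ℤ * Σ[ k ] (λ t → C₂ r t * G t j) + - h j * β r
      ≡⟨ Σ-linear k 1ℤ (- h j) _ _ ⟨
    Σ[ k ] (λ t → 1ℤ * (C₂ r t * G t j) + - h j * (C₂ r t * α t))
      ≡⟨ Σ-cong k (λ t → split₂ (C₂ r t) (G t j) (α t) (h j)) ⟩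
    Σ[ k ] (λ t → C₂ r t * E t j)
      ∎
    where
    split₁ : ∀ c b v g → (c - b * v) * g ≡ 1ℤ * (c * g) + - b * (v * g)
    split₁ = solve-∀
    swap : ∀ b x → - b * x ≡ - x * b
    swap = solve-∀
    split₂ : ∀ c g a x → 1ℤ * (c * g) + - x * (c * a) ≡ c * (g - a * x)
    split₂ = solve-∀
  H≈ : H ≈M (C ⊗ G)
  H≈ zero    j       = refl
  H≈ (suc r) zero    = sym (trans (combination-E r zero)
    (Σ-zero k (λ t → trans (cong (C₂ r t *_) (E-zero t)) (ℤP.*-zeroʳ (C₂ r t)))))
  H≈ (suc r) (suc j) = trans (H′≈ r j) (sym (combination-E r (suc j)))

invertible⇒⊑ : ∀ {k m} {H : Mat m m} → Invertible H → (A : Mat k m) → A ⊑ H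
invertible⇒⊑ (H⁻¹ , _ , H⁻¹⊗H≈1) A = A ⊗ H⁻¹ , ≈M-sym (⊗-inverseʳ A H⁻¹⊗H≈1)

·-++ : ∀ {m n c} (q : Vector ℤ (m ℕ.+ n)) (A : Mat m c) (B : Mat n c) j →
  (q · (A ++ᵥ B)) j ≡ ((q ∘ (_↑ˡ n)) · A) j + ((q ∘ (m ↑ʳ_)) · B) j
·-++ {m} {n} q A B j = trans (Σ-++ m n _) (cong₂ _+_
  (Σ-cong m (λ i → cong (λ r → q (i ↑ˡ n) * r j) (lookup-++ˡ A B i)))
  (Σ-cong n (λ i → cong (λ r → q (m ↑ʳ i) * r j) (lookup-++ʳ A B i))))

-- The square generator of the rows of S and F is a common right factor, hence unimodular.
coprime⇒spanning : ∀ {m n} (S : Mat m m) (F : Mat n m) → Coprime S F →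
  ∀ (w : Vector ℤ m) → ∃₂ λ x p → ∀ j → w j ≡ (x · S) j + (p · F) j
coprime⇒spanning {m} {n} S F coprime w = q ∘ (_↑ˡ n) , q ∘ (m ↑ʳ_) , λ j →
  trans (proj₂ w∈G zero j) (·-++ q S F j)
  where
  G = S ++ᵥ F
  gen = squareGenerator m (m ℕ.+ n) G
  H = proj₁ gen
  C = proj₁ (proj₁ (proj₂ gen))
  G≈CH = proj₂ (proj₁ (proj₂ gen))
  S≈ : S ≈M ((C ∘ (_↑ˡ n)) ⊗ H)
  S≈ i j = trans (cong (λ r → r j) (sym (lookup-++ˡ S F i))) (G≈CH (i ↑ˡ n) j)
  F≈ : F ≈M ((C ∘ (m ↑ʳ_)) ⊗ H)
  F≈ i j = trans (cong (λ r → r j) (sym (lookup-++ʳ S F i))) (G≈CH (m ↑ʳ i) j)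
  H-invertible = unimodular⇒invertible H (coprime H (C ∘ (_↑ˡ n)) (C ∘ (m ↑ʳ_)) S≈ F≈)
  w∈G = ⊑-trans (invertible⇒⊑ H-invertible (row w)) (proj₂ (proj₂ gen))
  q = proj₁ w∈G zero

⊑-diagonal⇒∣ : ∀ {n} {D : Mat n n} → Diagonal D → ∀ y → row y ⊑ D → diagonal D ∣ᵛ y
⊑-diagonal⇒∣ D-diag y (Q , y≈QD) j = divides (Q zero j) (trans (y≈QD zero j) (·-diagonal D-diag (Q zero) j))

∣⇒⊑-diagonal : ∀ {n} {D : Mat n n} → Diagonal D → ∀ y → diagonal D ∣ᵛ y → row y ⊑ D
∣⇒⊑-diagonal D-diag y D∣y = row (λ j → _∣_.quotient (D∣y j)) , λ _ j →
  trans (_∣_.equality (D∣y j)) (sym (·-diagonal D-diag (λ i → _∣_.quotient (D∣y i)) j))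

module _ {k n : ℕ} {U D V : Mat n n} (U-inv : Invertible U) (V-inv : Invertible V) where
  private
    U⁻¹ = proj₁ U-inv
    V⁻¹ = proj₁ V-inv
  open ≈M-Reasoning

  ⊑-UDV⇒⊑ : ∀ (A : Mat k n) → (A ⊗ V) ⊑ ((U ⊗ D) ⊗ V) → A ⊑ D
  ⊑-UDV⇒⊑ A (Q , AV≈QUDV) = Q ⊗ U , (begin
    A                           ≈⟨ ⊗-inverseʳ A (proj₁ (proj₂ V-inv)) ⟨
    (A ⊗ V) ⊗ V⁻¹               ≈⟨ ⊗-congˡ V⁻¹ AV≈QUDV ⟩
    (Q ⊗ ((U ⊗ D) ⊗ V)) ⊗ V⁻¹   ≈⟨ ⊗-congˡ V⁻¹ (⊗-assoc Q (U ⊗ D) V) ⟨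
    ((Q ⊗ (U ⊗ D)) ⊗ V) ⊗ V⁻¹   ≈⟨ ⊗-inverseʳ (Q ⊗ (U ⊗ D)) (proj₁ (proj₂ V-inv)) ⟩
    Q ⊗ (U ⊗ D)                 ≈⟨ ⊗-assoc Q U D ⟨
    (Q ⊗ U) ⊗ D                 ∎)

  ⊑⇒⊑-UDV : ∀ (A : Mat k n) → A ⊑ D → (A ⊗ V) ⊑ ((U ⊗ D) ⊗ V)
  ⊑⇒⊑-UDV A (Q , A≈QD) = Q ⊗ U⁻¹ , (begin
    A ⊗ V                       ≈⟨ ⊗-congˡ V A≈QD ⟩
    (Q ⊗ D) ⊗ V                 ≈⟨ ⊗-congˡ V (⊗-cancel Q D (proj₂ (proj₂ U-inv))) ⟨
    ((Q ⊗ U⁻¹) ⊗ (U ⊗ D)) ⊗ V   ≈⟨ ⊗-assoc (Q ⊗ U⁻¹) (U ⊗ D) V ⟩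
    (Q ⊗ U⁻¹) ⊗ ((U ⊗ D) ⊗ V)   ∎)

-- Finite quotients

residue : ℤ → (d : ℕ) .{{_ : NonZero d}} → Fin d
residue v d = fromℕ< (n%ℕd<d v d)

residue-unique : ∀ {d r r′} → r ℕ.< d → r′ ℕ.< d → + d ∣ + r - + r′ → r ≡ r′
residue-unique {d} {r} {r′} r<d r′<d d∣r-r′ =
  ℤP.+-injective (ℤP.i-j≡0⇒i≡j (+ r) (+ r′) (ℤP.∣i∣≡0⇒i≡0 (small-multiple (∣⇒∣ᵤ d∣r-r′) ∣r-r′∣<d)))
  where
  ∣r-r′∣<d : ∣ + r - + r′ ∣ ℕ.< d
  ∣r-r′∣<d = begin-strict
    ∣ + r - + r′ ∣  ≡⟨ cong ∣_∣ (ℤP.m-n≡m⊖n r r′) ⟩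
    ∣ r ⊖ r′ ∣      ≤⟨ ℤP.∣m⊝n∣≤m⊔n r r′ ⟩
    r ℕ.⊔ r′       <⟨ ℕP.⊔-lub r<d r′<d ⟩
    d              ∎
    where open ℕP.≤-Reasoning
  small-multiple : ∀ {d x} → d ℕD.∣ x → x ℕ.< d → x ≡ 0
  small-multiple {x = zero}  _   _   = refl
  small-multiple {x = suc x} d∣x x<d = contradiction (ℕD.∣⇒≤ d∣x) (ℕP.<⇒≱ x<d)

residue-spec : ∀ v d .{{_ : NonZero d}} → + d ∣ + toℕ (residue v d) - v
residue-spec v d = divides (- (v /ℕ d)) (begin
  + toℕ (residue v d) - v                   ≡⟨ cong (λ r → + r - v) (FinP.toℕ-fromℕ< (n%ℕd<d v d)) ⟩
  + (v %ℕ d) - v                            ≡⟨ cong (_-_ (+ (v %ℕ d))) (a≡a%ℕn+[a/ℕn]*n v d) ⟩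
  + (v %ℕ d) - (+ (v %ℕ d) + v /ℕ d * + d)  ≡⟨ cancel (+ (v %ℕ d)) (v /ℕ d) (+ d) ⟩
  - (v /ℕ d) * + d                          ∎)
  where
  open ≡-Reasoning
  cancel : ∀ r q d → r - (r + q * d) ≡ - q * d
  cancel = solve-∀

residue-cong : ∀ v v′ d .{{_ : NonZero d}} → + d ∣ v - v′ → residue v d ≡ residue v′ d
residue-cong v v′ d d∣v-v′ = FinP.toℕ-injective (residue-unique (FinP.toℕ<n _) (FinP.toℕ<n _)
  (subst (+ d ∣_) (regroup (+ toℕ (residue v d)) (+ toℕ (residue v′ d)) v v′)
    (∣m∣n⇒∣m+n (∣m∣n⇒∣m-n (residue-spec v d) (residue-spec v′ d)) d∣v-v′)))
  where
  regroup : ∀ r r′ v v′ → r - v - (r′ - v′) + (v - v′) ≡ r - r′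
  regroup = solve-∀

residue-toℕ : ∀ d .{{_ : NonZero d}} (x : Fin d) → residue (+ toℕ x) d ≡ x
residue-toℕ d x = FinP.toℕ-injective (residue-unique (FinP.toℕ<n _) (FinP.toℕ<n x) (residue-spec (+ toℕ x) d))

∣-Σ : ∀ k {c} (f : Vector ℤ k) → (∀ t → c ∣ f t) → c ∣ Σ[ k ] f
∣-Σ zero    f _   = divides 0ℤ refl
∣-Σ (suc k) f c∣f = ∣m∣n⇒∣m+n (c∣f zero) (∣-Σ k (f ∘ suc) (c∣f ∘ suc))

∣-· : ∀ {n m c} {y : Vector ℤ n} (M : Mat n m) → (∀ i → c ∣ y i) → ∀ j → c ∣ (y · M) j
∣-· M c∣y j = ∣-Σ _ _ (λ t → ∣m⇒∣m*n (M t j) (c∣y t))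

-- y ↦ y M induces a well-defined, injective and surjective map ⊕ᵢ ℤ/aᵢ → ⊕ⱼ ℤ/bⱼ.
record InducesIso {n m} (a : Vector ℤ n) (b : Vector ℤ m) (M : Mat n m) : Set where
  field
    preserves : ∀ y → a ∣ᵛ y → b ∣ᵛ (y · M)
    reflects  : ∀ y → b ∣ᵛ (y · M) → a ∣ᵛ y
    onto      : ∀ (w : Vector ℤ m) → ∃ λ (y : Vector ℤ n) → b ∣ᵛ (λ j → w j - (y · M) j)

gcdᵛ : ℕ → ∀ {n} → Vector ℤ n → Vector ℤ n
gcdᵛ q a i = + gcd q ∣ a i ∣

module _ (q : ℕ) where

  gcd∣q : ∀ x → + gcd q ∣ x ∣ ∣ + q
  gcd∣q x = ∣ᵤ⇒∣ (gcd[m,n]∣m q ∣ x ∣)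

  gcd∣ : ∀ x → + gcd q ∣ x ∣ ∣ x
  gcd∣ x = ∣ᵤ⇒∣ (gcd[m,n]∣n q ∣ x ∣)

  -- Tensoring with ℤ/q: write gcd(q, aᵢ) = xᵢ q + zᵢ aᵢ by Bézout.
  InducesIso-gcd : ∀ {n m} {a : Vector ℤ n} {b : Vector ℤ m} {M : Mat n m} →
    InducesIso a b M → InducesIso (gcdᵛ q a) (gcdᵛ q b) M
  InducesIso-gcd {n} {m} {a} {b} {M} iso = record
    { preserves = preserves′ ; reflects = reflects′ ; onto = onto′ }
    where
    open InducesIso iso
    x : ∀ {k} → Vector ℤ k → Vector ℤ k
    x c i = proj₁ (bézout (+ q) (c i))
    z : ∀ {k} → Vector ℤ k → Vector ℤ k
    z c i = proj₁ (proj₂ (bézout (+ q) (c i)))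
    split : ∀ {k} (c : Vector ℤ k) i t → t * gcdᵛ q c i ≡ + q * (t * x c i) + 1ℤ * (t * z c i * c i)
    split c i t = trans (cong (t *_) (proj₂ (proj₂ (bézout (+ q) (c i))))) (distrib t (x c i) (+ q) (z c i) (c i))
      where
      distrib : ∀ t x q z c → t * (x * q + z * c) ≡ q * (t * x) + 1ℤ * (t * z * c)
      distrib = solve-∀
    preserves′ : ∀ y → gcdᵛ q a ∣ᵛ y → gcdᵛ q b ∣ᵛ (y · M)
    preserves′ y ga∣y j = subst (gcdᵛ q b j ∣_) (sym y·M≡) (∣m∣n⇒∣m+n
      (∣m⇒∣m*n ((u · M) j) (gcd∣q (b j)))
      (∣n⇒∣m*n 1ℤ (∣-trans (gcd∣ (b j)) (preserves v (λ i → divides (k i * z a i) refl) j))))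
      where
      k = λ i → _∣_.quotient (ga∣y i)
      u = λ i → k i * x a i
      v = λ i → k i * z a i * a i
      y·M≡ : (y · M) j ≡ + q * (u · M) j + 1ℤ * (v · M) j
      y·M≡ = trans (·-cong M (λ i → trans (_∣_.equality (ga∣y i)) (split a i (k i))) j)
                   (·-linear (+ q) 1ℤ u v M j)
    reflects′ : ∀ y → gcdᵛ q b ∣ᵛ (y · M) → gcdᵛ q a ∣ᵛ y
    reflects′ y gb∣yM i = subst (gcdᵛ q a i ∣_) (restore (+ q) (z′ i) (y i))
      (∣m∣n⇒∣m+n (∣-trans (gcd∣ (a i)) (reflects y′ b∣y′M i)) (∣n⇒∣m*n (z′ i) (gcd∣q (a i))))
      where
      k = λ j → _∣_.quotient (gb∣yM j)
      w = λ j → k j * x b j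
      z′ = proj₁ (onto w)
      y′ = λ i → - + q * z′ i + 1ℤ * y i
      b∣y′M : b ∣ᵛ (y′ · M)
      b∣y′M j = subst (b j ∣_) (sym y′·M≡)
        (∣m∣n⇒∣m+n (∣n⇒∣m*n (+ q) (proj₂ (onto w) j)) (divides (k j * z b j) refl))
        where
        y′·M≡ : (y′ · M) j ≡ + q * (w j - (z′ · M) j) + k j * z b j * b j
        y′·M≡ = begin
          (y′ · M) j
            ≡⟨ ·-linear (- + q) 1ℤ z′ y M j ⟩
          - + q * (z′ · M) j + 1ℤ * (y · M) j
            ≡⟨ cong (λ t → - + q * (z′ · M) j + 1ℤ * t) (trans (_∣_.equality (gb∣yM j)) (split b j (k j))) ⟩
          - + q * (z′ · M) j + 1ℤ * (+ q * w j + 1ℤ * (k j * z b j * b j))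
            ≡⟨ regroup (+ q) ((z′ · M) j) (w j) _ ⟩
          + q * (w j - (z′ · M) j) + k j * z b j * b j
            ∎
          where
          open ≡-Reasoning
          regroup : ∀ q f w e → - q * f + 1ℤ * (q * w + 1ℤ * e) ≡ q * (w - f) + e
          regroup = solve-∀
      restore : ∀ q z y → - q * z + 1ℤ * y + z * q ≡ y
      restore = solve-∀
    onto′ : ∀ (w : Vector ℤ m) → ∃ λ (y : Vector ℤ n) → gcdᵛ q b ∣ᵛ (λ j → w j - (y · M) j)
    onto′ w = proj₁ (onto w) , λ j → ∣-trans (gcd∣ (b j)) (proj₂ (onto w) j)

∏ : ∀ {n} → Vector ℕ n → ℕ
∏ = foldr ℕ._*_ 1

Residues : ∀ {n} → Vector ℕ n → Set
Residues {zero}  a = ⊤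
Residues {suc n} a = Fin (head a) × Residues (tail a)

Residues↔Fin∏ : ∀ {n} (a : Vector ℕ n) → Residues a ↔ Fin (∏ a)
Residues↔Fin∏ {zero}  a = ↔-sym FinP.1↔⊤
Residues↔Fin∏ {suc n} a = ↔-trans (↔-refl ×-↔ Residues↔Fin∏ (tail a)) (↔-sym FinP.*↔×)

_≡_[mod_] : ∀ {n} → Vector ℤ n → Vector ℤ n → Vector ℕ n → Set
y ≡ z [mod a ] = ∀ i → + a i ∣ y i - z i

≡mod-sym : ∀ {n} (y z : Vector ℤ n) {a} → y ≡ z [mod a ] → z ≡ y [mod a ]
≡mod-sym y z y≡z i = subst (_ ∣_) (neg-diff (y i) (z i)) (∣m⇒∣-m (y≡z i))
  where
  neg-diff : ∀ y z → - (y - z) ≡ z - y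
  neg-diff = solve-∀

≡mod-trans : ∀ {n} (x y z : Vector ℤ n) {a} → x ≡ y [mod a ] → y ≡ z [mod a ] → x ≡ z [mod a ]
≡mod-trans x y z x≡y y≡z i = subst (_ ∣_) (telescope (x i) (y i) (z i)) (∣m∣n⇒∣m+n (x≡y i) (y≡z i))
  where
  telescope : ∀ x y z → x - y + (y - z) ≡ x - z
  telescope = solve-∀

reduce : ∀ {n} (a : Vector ℕ n) → (∀ i → NonZero (a i)) → Vector ℤ n → Residues a
reduce {zero}  a a≢0 y = tt
reduce {suc n} a a≢0 y = residue (y zero) (a zero) {{a≢0 zero}} , reduce (tail a) (a≢0 ∘ suc) (tail y)

lift : ∀ {n} (a : Vector ℕ n) → Residues a → Vector ℤ n
lift {suc n} a (r , rs) zero    = + toℕ r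
lift {suc n} a (r , rs) (suc i) = lift (tail a) rs i

reduce-lift : ∀ {n} (a : Vector ℕ n) a≢0 r → reduce a a≢0 (lift a r) ≡ r
reduce-lift {zero}  a a≢0 tt       = refl
reduce-lift {suc n} a a≢0 (r , rs) =
  cong₂ _,_ (residue-toℕ (a zero) {{a≢0 zero}} r) (reduce-lift (tail a) (a≢0 ∘ suc) rs)

lift-reduce : ∀ {n} (a : Vector ℕ n) a≢0 y → lift a (reduce a a≢0 y) ≡ y [mod a ]
lift-reduce {suc n} a a≢0 y zero    = residue-spec (y zero) (a zero) {{a≢0 zero}}
lift-reduce {suc n} a a≢0 y (suc i) = lift-reduce (tail a) (a≢0 ∘ suc) (tail y) i

reduce-cong : ∀ {n} (a : Vector ℕ n) a≢0 y z → y ≡ z [mod a ] → reduce a a≢0 y ≡ reduce a a≢0 z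
reduce-cong {zero}  a a≢0 y z y≡z = refl
reduce-cong {suc n} a a≢0 y z y≡z =
  cong₂ _,_ (residue-cong (y zero) (z zero) (a zero) {{a≢0 zero}} (y≡z zero))
            (reduce-cong (tail a) (a≢0 ∘ suc) (tail y) (tail z) (y≡z ∘ suc))

-- The isomorphism lifts to a bijection between residue systems, which are finite of size ∏ a and ∏ b.
InducesIso⇒∏≡ : ∀ {n m} (a : Vector ℕ n) (b : Vector ℕ m) {M : Mat n m} →
  (∀ i → NonZero (a i)) → (∀ j → NonZero (b j)) → InducesIso (+_ ∘ a) (+_ ∘ b) M → ∏ a ≡ ∏ b
InducesIso⇒∏≡ a b {M} a≢0 b≢0 iso =
  ↔⇒≡ (↔-trans (↔-sym (Residues↔Fin∏ a)) (↔-trans (mk↔ₛ′ f g f∘g g∘f) (Residues↔Fin∏ b)))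
  where
  open InducesIso iso
  preserves≡ : ∀ y z → y ≡ z [mod a ] → (y · M) ≡ (z · M) [mod b ]
  preserves≡ y z y≡z j = subst (_ ∣_) (·-difference y z M j) (preserves _ y≡z j)
  reflects≡ : ∀ y z → (y · M) ≡ (z · M) [mod b ] → y ≡ z [mod a ]
  reflects≡ y z yM≡zM = reflects _ (λ j → subst (_ ∣_) (sym (·-difference y z M j)) (yM≡zM j))
  preimage : Vector ℤ _ → Vector ℤ _
  preimage w = proj₁ (onto w)
  f : Residues a → Residues b
  f r = reduce b b≢0 (lift a r · M)
  g : Residues b → Residues a
  g r = reduce a a≢0 (preimage (lift b r))
  f∘g : ∀ r → f (g r) ≡ r
  f∘g r = trans (reduce-cong b b≢0 (y′ · M) w
                  (≡mod-trans (y′ · M) (y · M) w (preserves≡ y′ y (lift-reduce a a≢0 y))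
                                                 (≡mod-sym w (y · M) (proj₂ (onto w)))))
                (reduce-lift b b≢0 r)
    where
    w = lift b r
    y = preimage w
    y′ = lift a (reduce a a≢0 y)
  g∘f : ∀ r → g (f r) ≡ r
  g∘f r = trans (reduce-cong a a≢0 (preimage w) x
                  (reflects≡ (preimage w) x (≡mod-trans (preimage w · M) w (x · M)
                    (≡mod-sym w (preimage w · M) (proj₂ (onto w))) (lift-reduce b b≢0 (x · M)))))
                (reduce-lift a a≢0 r)
    where
    x = lift a r
    w = lift b (reduce b b≢0 (x · M))

∏-∣ : ∀ {n} (a : Vector ℕ n) i → a i ℕD.∣ ∏ a
∏-∣ a zero    = ℕD.m∣m*n _
∏-∣ a (suc i) = ℕD.∣-trans (∏-∣ (tail a) i) (ℕD.n∣m*n (a zero))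

∏≢0 : ∀ {n} (a : Vector ℕ n) → (∀ i → NonZero (a i)) → NonZero (∏ a)
∏≢0 {zero}  a a≢0 = _
∏≢0 {suc n} a a≢0 = ℕP.m*n≢0 (a zero) (∏ (tail a)) {{a≢0 zero}} {{∏≢0 (tail a) (a≢0 ∘ suc)}}

InducesIso⇒≢0 : ∀ {n m} {a : Vector ℤ n} {b : Vector ℤ m} {M : Mat n m} → InducesIso a b M →
  ∀ N .{{_ : NonZero N}} → (∀ j → b j ∣ + N) → ∀ i → a i ≢ 0ℤ
InducesIso⇒≢0 {M = M} iso N b∣N i aᵢ≡0 = ℕ.≢-nonZero⁻¹ N (ℤP.+-injective (0∣⇒≡0 (subst (_∣ + N) aᵢ≡0 aᵢ∣N)))
  where aᵢ∣N = InducesIso.reflects iso (λ _ → + N) (λ j → ∣-· M (λ _ → b∣N j) j) i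

-- Invariant factors

gcdProduct : ℕ → List ℕ → ℕ
gcdProduct q xs = product (map (gcd q) xs)

≢1? : ∀ (x : ℕ) → Dec (x ≢ 1)
≢1? x = ¬? (x ℕ.≟ 1)

nontrivialℕ : List ℕ → List ℕ
nontrivialℕ = filter ≢1?

product-∷ʳ : ∀ xs x → product (xs ∷ʳ x) ≡ product xs ℕ.* x
product-∷ʳ xs x = trans (product-++ xs [ x ]) (cong (product xs ℕ.*_) (ℕP.*-identityʳ x))

gcdProduct-∷ʳ : ∀ q xs x → gcdProduct q (xs ∷ʳ x) ≡ gcdProduct q xs ℕ.* gcd q x
gcdProduct-∷ʳ q xs x = trans (cong product (ListP.map-++ (gcd q) xs [ x ])) (product-∷ʳ (map (gcd q) xs) (gcd q x))

gcd-divisor : ∀ {N x} → x ℕD.∣ N → gcd N x ≡ x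
gcd-divisor {N} {x} x∣N = ℕD.∣-antisym (gcd[m,n]∣n N x) (gcd-greatest x∣N ℕD.∣-refl)

gcdProduct-divisors : ∀ {N xs} → All (ℕD._∣ N) xs → gcdProduct N xs ≡ product xs
gcdProduct-divisors []           = refl
gcdProduct-divisors (x∣N ∷ xs∣N) = cong₂ ℕ._*_ (gcd-divisor x∣N) (gcdProduct-divisors xs∣N)

gcdProduct≤product : ∀ q {xs} → All NonZero xs → gcdProduct q xs ℕ.≤ product xs
gcdProduct≤product q []               = ℕP.≤-refl
gcdProduct≤product q {x ∷ _} (x≢0 ∷ xs≢0) =
  ℕP.*-mono-≤ (gcd[m,n]≤n q x {{x≢0}}) (gcdProduct≤product q xs≢0)

gcd≢0 : ∀ q x .{{_ : NonZero q}} → NonZero (gcd q x)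
gcd≢0 q x = ℕ.≢-nonZero (gcd[m,n]≢0 q x (inj₁ (ℕ.≢-nonZero⁻¹ q)))

AllPairs-∷ʳ⁻ : ∀ {R : ℕ → ℕ → Set} xs {x} → AllPairs R (xs ∷ʳ x) → All (λ y → R y x) xs × AllPairs R xs
AllPairs-∷ʳ⁻ []       _           = [] , []
AllPairs-∷ʳ⁻ (y ∷ ys) (Ry ∷ Rys) =
  proj₂ (AllP.∷ʳ⁻ Ry) ∷ proj₁ (AllPairs-∷ʳ⁻ ys Rys) , proj₁ (AllP.∷ʳ⁻ Ry) ∷ proj₂ (AllPairs-∷ʳ⁻ ys Rys)

*-≤-equality : ∀ {p P g Y} .{{_ : NonZero P}} → p ℕ.≤ P → g ℕ.≤ Y → p ℕ.* g ≡ P ℕ.* Y → g ≡ Y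
*-≤-equality {p} {P} {g} {Y} p≤P g≤Y pg≡PY = ℕP.≤-antisym g≤Y (ℕP.*-cancelˡ-≤ P (begin
  P ℕ.* Y  ≡⟨ pg≡PY ⟨
  p ℕ.* g  ≤⟨ ℕP.*-monoˡ-≤ g p≤P ⟩
  P ℕ.* g  ∎))
  where open ℕP.≤-Reasoning

SameGcdProducts : List ℕ → List ℕ → Set
SameGcdProducts xs ys = ∀ q .{{_ : NonZero q}} → gcdProduct q xs ≡ gcdProduct q ys

-- With q = x y both sides are the full products; with q = x the left side still is,
-- which forces gcd(x, y) = y on the right.
last∣last : ∀ {xs x ys y} → All (ℕD._∣ x) xs → All (ℕD._∣ y) ys → All NonZero ys →
  .{{_ : NonZero x}} → .{{_ : NonZero y}} → SameGcdProducts (xs ∷ʳ x) (ys ∷ʳ y) → y ℕD.∣ x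
last∣last {xs} {x} {ys} {y} xs∣x ys∣y ys≢0 agree =
  subst (ℕD._∣ x) gcd[x,y]≡y (gcd[m,n]∣m x y)
  where
  instance
    _ = product≢0 ys≢0
    _ = ℕP.m*n≢0 x y
  divides-xy : ∀ {zs z} → All (ℕD._∣ z) zs → z ℕD.∣ x ℕ.* y → All (ℕD._∣ x ℕ.* y) (zs ∷ʳ z)
  divides-xy zs∣z z∣xy = AllP.∷ʳ⁺ (All.map (λ w∣z → ℕD.∣-trans w∣z z∣xy) zs∣z) z∣xy
  products : product (xs ∷ʳ x) ≡ product (ys ∷ʳ y)
  products = trans (sym (gcdProduct-divisors (divides-xy xs∣x (ℕD.m∣m*n y))))
                   (trans (agree (x ℕ.* y)) (gcdProduct-divisors (divides-xy ys∣y (ℕD.n∣m*n x))))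
  gcd[x,y]≡y : gcd x y ≡ y
  gcd[x,y]≡y = *-≤-equality (gcdProduct≤product x ys≢0) (gcd[m,n]≤n x y) (begin
    gcdProduct x ys ℕ.* gcd x y ≡⟨ gcdProduct-∷ʳ x ys y ⟨
    gcdProduct x (ys ∷ʳ y)      ≡⟨ agree x ⟨
    gcdProduct x (xs ∷ʳ x)      ≡⟨ gcdProduct-divisors (AllP.∷ʳ⁺ xs∣x ℕD.∣-refl) ⟩
    product (xs ∷ʳ x)           ≡⟨ products ⟩
    product (ys ∷ʳ y)           ≡⟨ product-∷ʳ ys y ⟩
    product ys ℕ.* y            ∎)
    where open ≡-Reasoning

nontrivialℕ≡[] : ∀ {ys} → All NonZero ys → SameGcdProducts [] ys → nontrivialℕ ys ≡ []
nontrivialℕ≡[] []                    agree = refl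
nontrivialℕ≡[] {y ∷ ys} (y≢0 ∷ ys≢0) agree =
  trans (ListP.filter-reject ≢1? (λ y≢1 → y≢1 y≡1))
        (nontrivialℕ≡[] ys≢0 (λ q → sym (ℕP.m*n≡1⇒n≡1 (gcd q y) _ (sym (agree q)))))
  where
  instance _ = y≢0
  y≡1 : y ≡ 1
  y≡1 = trans (sym (gcd-divisor ℕD.∣-refl)) (ℕP.m*n≡1⇒m≡1 (gcd y y) _ (sym (agree y)))

private
  uniqueʳ : ∀ {xs ys} → Reverse xs → Reverse ys → AllPairs ℕD._∣_ xs → AllPairs ℕD._∣_ ys →
    All NonZero xs → All NonZero ys → SameGcdProducts xs ys → nontrivialℕ xs ≡ nontrivialℕ ys
  uniqueʳ []               []               _  _  _     _     agree = refl
  uniqueʳ []               (ys ∶ _ ∶ʳ y)    _  _  _     ys≢0  agree = sym (nontrivialℕ≡[] ys≢0 agree)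
  uniqueʳ (xs ∶ _ ∶ʳ x)    []               _  _  xs≢0  _     agree = nontrivialℕ≡[] xs≢0 (λ q → sym (agree q))
  uniqueʳ (xs ∶ rxs ∶ʳ x)  (ys ∶ rys ∶ʳ y)  cx cy nx    ny    agree = begin
    nontrivialℕ (xs ∷ʳ x)                ≡⟨ ListP.filter-++ ≢1? xs [ x ] ⟩
    nontrivialℕ xs ++ nontrivialℕ [ x ]  ≡⟨ cong₂ (λ zs z → zs ++ nontrivialℕ [ z ]) rest x≡y ⟩
    nontrivialℕ ys ++ nontrivialℕ [ y ]  ≡⟨ ListP.filter-++ ≢1? ys [ y ] ⟨
    nontrivialℕ (ys ∷ʳ y)                ∎
    where
    open ≡-Reasoning
    xs∣x = proj₁ (AllPairs-∷ʳ⁻ xs cx)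
    ys∣y = proj₁ (AllPairs-∷ʳ⁻ ys cy)
    xs≢0 = proj₁ (AllP.∷ʳ⁻ nx)
    ys≢0 = proj₁ (AllP.∷ʳ⁻ ny)
    instance
      _ = proj₂ (AllP.∷ʳ⁻ nx)
      _ = proj₂ (AllP.∷ʳ⁻ ny)
    x≡y : x ≡ y
    x≡y = ℕD.∣-antisym (last∣last ys∣y xs∣x xs≢0 (λ q → sym (agree q))) (last∣last xs∣x ys∣y ys≢0 agree)
    agree′ : SameGcdProducts xs ys
    agree′ q = ℕP.*-cancelʳ-≡ _ _ (gcd q x) {{gcd≢0 q x}} (begin
      gcdProduct q xs ℕ.* gcd q x  ≡⟨ gcdProduct-∷ʳ q xs x ⟨
      gcdProduct q (xs ∷ʳ x)       ≡⟨ agree q ⟩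
      gcdProduct q (ys ∷ʳ y)       ≡⟨ gcdProduct-∷ʳ q ys y ⟩
      gcdProduct q ys ℕ.* gcd q y  ≡⟨ cong (λ z → gcdProduct q ys ℕ.* gcd q z) x≡y ⟨
      gcdProduct q ys ℕ.* gcd q x  ∎)
    rest : nontrivialℕ xs ≡ nontrivialℕ ys
    rest = uniqueʳ rxs rys (proj₂ (AllPairs-∷ʳ⁻ xs cx)) (proj₂ (AllPairs-∷ʳ⁻ ys cy)) xs≢0 ys≢0 agree′

nontrivial-unique : ∀ {xs ys} → AllPairs ℕD._∣_ xs → AllPairs ℕD._∣_ ys →
  All NonZero xs → All NonZero ys → SameGcdProducts xs ys → nontrivialℕ xs ≡ nontrivialℕ ys
nontrivial-unique {xs} {ys} = uniqueʳ (reverseView xs) (reverseView ys)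

-- Relations lattices

relations-iso : ∀ {m n} {S : Mat m m} {F : Mat n m} {P U D V : Mat n n} →
  Diagonal S → Diagonal D → Coprime S F → IsRelationsBasis S F P →
  Invertible U → Invertible V → P ≈M ((U ⊗ D) ⊗ V) → InducesIso (diagonal D) (diagonal S) (V ⊗ F)
relations-iso {S = S} {F} {P} {U} {D} {V} S-diag D-diag coprime (_ , basis) U-inv V-inv P≈UDV =
  record { preserves = preserves ; reflects = reflects ; onto = onto }
  where
  preserves : ∀ y → diagonal D ∣ᵛ y → diagonal S ∣ᵛ (y · (V ⊗ F))
  preserves y D∣y j = subst (S j j ∣_) (sym (·-⊗ y V F j)) (⊑-diagonal⇒∣ S-diag ((y · V) · F) yVF⊑S j)
    where
    yVF⊑S = Equivalence.from (basis (row (y · V)))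
              (⊑-respʳ (≈M-sym P≈UDV) (⊑⇒⊑-UDV U-inv V-inv (row y) (∣⇒⊑-diagonal D-diag y D∣y)))
  reflects : ∀ y → diagonal S ∣ᵛ (y · (V ⊗ F)) → diagonal D ∣ᵛ y
  reflects y S∣yVF = ⊑-diagonal⇒∣ D-diag y (⊑-UDV⇒⊑ U-inv V-inv (row y) (⊑-respʳ P≈UDV yV⊑P))
    where
    yV⊑P = Equivalence.to (basis (row (y · V)))
             (∣⇒⊑-diagonal S-diag ((y · V) · F) (λ j → subst (S j j ∣_) (·-⊗ y V F j) (S∣yVF j)))
  V⁻¹ = proj₁ V-inv
  onto : ∀ w → ∃ λ y → diagonal S ∣ᵛ (λ j → w j - (y · (V ⊗ F)) j)
  onto w = p · V⁻¹ , λ j → divides (x j) (begin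
    w j - ((p · V⁻¹) · (V ⊗ F)) j
      ≡⟨ cong₂ _-_ (w≡xS+pF j) (⊗-cancel (row p) F (proj₂ (proj₂ V-inv)) zero j) ⟩
    (x · S) j + (p · F) j - (p · F) j         ≡⟨ add-sub ((x · S) j) ((p · F) j) ⟩
    (x · S) j                                 ≡⟨ ·-diagonal S-diag x j ⟩
    x j * S j j                               ∎)
    where
    open ≡-Reasoning
    spanning = coprime⇒spanning S F coprime w
    x = proj₁ spanning
    p = proj₁ (proj₂ spanning)
    w≡xS+pF = proj₂ (proj₂ spanning)
    add-sub : ∀ a b → a + b - b ≡ a
    add-sub = solve-∀

absDiagList : ∀ {n} → Mat n n → List ℕ
absDiagList D = map ∣_∣ (diagList D)

gcdProduct-absDiagList : ∀ q {n} (D : Mat n n) → gcdProduct q (absDiagList D) ≡ ∏ (λ i → gcd q ∣ D i i ∣)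
gcdProduct-absDiagList q {zero}  D = refl
gcdProduct-absDiagList q {suc n} D = cong (gcd q ∣ D zero zero ∣ ℕ.*_) (gcdProduct-absDiagList q (minor D zero))

absDiagList-linked : ∀ {n} (D : Mat n n) → (∀ i j → toℕ j ≡ suc (toℕ i) → D i i ℤᵘ.∣ D j j) →
  Linked ℕD._∣_ (absDiagList D)
absDiagList-linked {zero}        D chain = []
absDiagList-linked {suc zero}    D chain = [-]
absDiagList-linked {suc (suc n)} D chain =
  chain zero (suc zero) refl ∷ absDiagList-linked (minor D zero) (λ i j → chain (suc i) (suc j) ∘ cong suc)

absDiagList-nonzero : ∀ {n} (D : Mat n n) → (∀ i → D i i ≢ 0ℤ) → All NonZero (absDiagList D)
absDiagList-nonzero {zero}  D D≢0 = []
absDiagList-nonzero {suc n} D D≢0 =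
  ℕ.≢-nonZero (D≢0 zero ∘ ℤP.∣i∣≡0⇒i≡0) ∷ absDiagList-nonzero (minor D zero) (D≢0 ∘ suc)

≢+1? : ∀ (x : ℤ) → Dec (x ≢ + 1)
≢+1? x = ¬? (x ℤP.≟ + 1)

nontrivial-map-+ : ∀ xs → filter ≢+1? (map (λ k → + k) xs) ≡ map (λ k → + k) (nontrivialℕ xs)
nontrivial-map-+ []       = refl
nontrivial-map-+ (x ∷ xs) with x ℕ.≟ 1
... | yes refl = trans (ListP.filter-reject ≢+1? {xs = map (λ k → + k) xs} (λ ne → ne refl))
  (trans (nontrivial-map-+ xs) (cong (map (λ k → + k)) (sym (ListP.filter-reject ≢1? {xs = xs} (λ ne → ne refl)))))
... | no  x≢1  = trans (ListP.filter-accept ≢+1? {xs = map (λ k → + k) xs} (x≢1 ∘ ℤP.+-injective))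
  (trans (cong (+ x ∷_) (nontrivial-map-+ xs))
         (cong (map (λ k → + k)) (sym (ListP.filter-accept ≢1? {xs = xs} x≢1))))

diagList-abs : ∀ {n} (D : Mat n n) → (∀ i → 0ℤ ℤ.≤ D i i) → diagList D ≡ map (λ k → + k) (absDiagList D)
diagList-abs {zero}  D D≥0 = refl
diagList-abs {suc n} D D≥0 =
  cong₂ _∷_ (sym (ℤP.0≤i⇒+∣i∣≡i (D≥0 zero))) (diagList-abs (minor D zero) (D≥0 ∘ suc))

nontrivial-abs : ∀ {n} (D : Mat n n) → (∀ i → 0ℤ ℤ.≤ D i i) →
  nontrivial D ≡ map (λ k → + k) (nontrivialℕ (absDiagList D))
nontrivial-abs D D≥0 = trans (cong (filter ≢+1?) (diagList-abs D D≥0)) (nontrivial-map-+ (absDiagList D))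

theorem21 : ∀ {m n : ℕ} (S : Mat m m) (F : Mat n m) →
    IsSmithForm S → Nonsingular S → Coprime S F →
    ∀ (P : Mat n n) → IsRelationsBasis S F P →
    ∀ (U D V : Mat n n) → Unimodular U → Unimodular V → IsSmithForm D →
    P ≈M ((U ⊗ D) ⊗ V) →
    nontrivial D ≡ nontrivial S
theorem21 S F (S-diag , S≥0 , S-chain) S-nonsingular coprime P P-basis U D V U-unimodular V-unimodular
          (D-diag , D≥0 , D-chain) P≈UDV = begin
  nontrivial D                                    ≡⟨ nontrivial-abs D D≥0 ⟩
  map (λ k → + k) (nontrivialℕ (absDiagList D))   ≡⟨ cong (map (λ k → + k)) invariant-factors ⟩
  map (λ k → + k) (nontrivialℕ (absDiagList S))   ≡⟨ nontrivial-abs S S≥0 ⟨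
  nontrivial S                                    ∎
  where
  open ≡-Reasoning
  iso = relations-iso S-diag D-diag coprime P-basis
          (unimodular⇒invertible U U-unimodular) (unimodular⇒invertible V V-unimodular) P≈UDV
  S≢0 = diagonal-nonsingular S S-diag S-nonsingular
  N = ∏ (λ j → ∣ S j j ∣)
  instance _ = ∏≢0 _ (λ j → ℕ.≢-nonZero (S≢0 j ∘ ℤP.∣i∣≡0⇒i≡0))
  -- The diagonal of D divides N.
  D≢0 = InducesIso⇒≢0 iso N (λ j → ∣ᵤ⇒∣ (∏-∣ (λ j → ∣ S j j ∣) j))
  agree : SameGcdProducts (absDiagList D) (absDiagList S)
  agree q = trans (gcdProduct-absDiagList q D) (trans
    (InducesIso⇒∏≡ _ _ (λ i → gcd≢0 q ∣ D i i ∣) (λ j → gcd≢0 q ∣ S j j ∣) (InducesIso-gcd q iso))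
    (sym (gcdProduct-absDiagList q S)))
  invariant-factors : nontrivialℕ (absDiagList D) ≡ nontrivialℕ (absDiagList S)
  invariant-factors = nontrivial-unique
    (Linked⇒AllPairs ℕD.∣-trans (absDiagList-linked D D-chain))
    (Linked⇒AllPairs ℕD.∣-trans (absDiagList-linked S S-chain))
    (absDiagList-nonzero D D≢0) (absDiagList-nonzero S S≢0) agree
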